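{- Let $G=(V,E)$ be a connected simple planar graph and let $e\in E$ be an edge that is not a bridge. Let $G'$ (the doubling) be obtained from $G$ by replacing each edge other than $e$ by two parallel edges; let $G''$ (the halving) be obtained from $G$ by subdividing each edge other than $e$ (replacing it by a path of length $2$); and let $G^\circ$ (the simplification) be obtained by first doubling and then halving, i.e. by subdividing each edge of $G'$ other than $e$. Then \[ \zeta(G',e)=2\,\zeta(G,e),\qquad \zeta(G'',e)=\frac{\zeta(G,e)}{2},\qquad \zeta(G^\circ,e)=\zeta(G,e). \]
   Context: Graphs have no loops but may have multiple edges; a simple graph has no multiple edges. For a graph $H$, $\tau(H)$ is the number of spanning trees; $H-e$ denotes deletion of edge $e$ and $H/e$ denotes contraction of $e$ with resulting loops removed. For a connected graph $H$ and a non-bridge edge $e$, the spanning tree ratio is $\zeta(H,e):=\tau(H-e)/\tau(H/e)$. -}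

module Defs where

open import Data.Nat using (ℕ; zero; suc; _+_; _≤_)
open import Data.Bool using (Bool; true; false; not)
open import Data.Fin using (Fin)
import Data.Fin as Fin
open import Data.Fin.Subset using (Subset) renaming (_∈_ to _∈ₛ_; ⊤ to fullSet)
open import Data.List using (List; []; _∷_; length; lookup; map; filter; concatMap; allFin)
open import Data.List.Membership.Propositional using (_∈_)
open import Data.List.Relation.Unary.Any using (Any)
open import Data.List.Relation.Unary.Unique.Propositional using (Unique)
open import Data.Product using (Σ; Σ-syntax; _×_; _,_; proj₁; proj₂; swap)
open import Data.Sum using (_⊎_; inj₁; inj₂)
import Data.Sum.Properties as SumP
open import Function using (_∘_)
open import Relation.Binary.PropositionalEquality using (_≡_; _≢_; refl)
open import Relation.Binary.Definitions using (DecidableEquality)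
open import Relation.Nullary using (¬_; ¬?; yes; no)
open import Relation.Nullary.Decidable using (False; fromWitnessFalse)

-- Finite multigraphs (no loops assumed by context; loops can simply be
-- absent from the edge list).  Edges are the positions of the list
-- 'edges', so parallel edges are repeated entries.

record Graph : Set₁ where
  field
    V     : Set
    edges : List (V × V)

open Graph public

EdgeIx : Graph → Set
EdgeIx G = Fin (length (edges G))

EdgeSet : Graph → Set
EdgeSet G = Subset (length (edges G))

Joins : {V : Set} → V × V → V → V → Set
Joins (a , b) x y = (a ≡ x × b ≡ y) ⊎ (a ≡ y × b ≡ x)

data Walk (G : Graph) (T : EdgeSet G) : V G → V G → Set where
  []   : ∀ {x} → Walk G T x x
  step : ∀ {x y z} (i : EdgeIx G) → i ∈ₛ T → Joins (lookup (edges G) i) x y →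
         Walk G T y z → Walk G T x z

walkEdges : ∀ {G T x y} → Walk G T x y → List (EdgeIx G)
walkEdges []               = []
walkEdges (step i _ _ w)   = i ∷ walkEdges w

-- the vertices at which the steps start (for a closed walk: every vertex once,
-- the final return to the start is not repeated)
walkVerts : ∀ {G T x y} → Walk G T x y → List (V G)
walkVerts []                     = []
walkVerts {x = x} (step _ _ _ w) = x ∷ walkVerts w

Cycle : (G : Graph) → EdgeSet G → Set
Cycle G T = Σ[ x ∈ V G ] Σ[ w ∈ Walk G T x x ]
              (1 ≤ length (walkEdges w) × Unique (walkEdges w) × Unique (walkVerts w))

ConnectedBy : (G : Graph) → EdgeSet G → Set
ConnectedBy G T = ∀ x y → Walk G T x y

Connected : Graph → Set
Connected G = ConnectedBy G fullSet

IsSpanningTree : (G : Graph) → EdgeSet G → Set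
IsSpanningTree G T = ConnectedBy G T × ¬ Cycle G T

HasCount : {A : Set} → (A → Set) → ℕ → Set
HasCount {A} P t = Σ[ L ∈ List A ] (Unique L × length L ≡ t ×
                     (∀ a → a ∈ L → P a) × (∀ a → P a → a ∈ L))

NumSpanningTrees : Graph → ℕ → Set
NumSpanningTrees G t = HasCount (IsSpanningTree G) t

record EGraph : Set₁ where
  field
    Vt   : Set
    _≟V_ : DecidableEquality Vt
    u v  : Vt
    rest : List (Vt × Vt)

open EGraph public

-- the whole graph H (edge e is edge number 0)
whole : EGraph → Graph
whole H = record { V = Vt H ; edges = (u H , v H) ∷ rest H }

deleteE : EGraph → Graph
deleteE H = record { V = Vt H ; edges = rest H }

-- H / e : vertex v is merged into u; vertex set V ∖ {v}; loops removed
module _ (H : EGraph) (u≢v : u H ≢ v H) where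
  private
    _≟_ = _≟V_ H
  CV : Set
  CV = Σ[ x ∈ Vt H ] False (x ≟ v H)

  merge : Vt H → CV
  merge x with x ≟ v H
  ... | yes _  = u H , fromWitnessFalse u≢v
  ... | no x≢v = x , fromWitnessFalse x≢v

  contractE : Graph
  contractE = record
    { V = CV
    ; edges = filter (λ p → ¬? (proj₁ (proj₁ p) ≟ proj₁ (proj₂ p)))
                     (map (λ p → merge (proj₁ p) , merge (proj₂ p)) (rest H)) }

double : EGraph → EGraph
double H = record H { rest = concatMap (λ p → p ∷ p ∷ []) (rest H) }

-- halving: every edge other than e subdivided; the i-th other edge gets the
-- new middle vertex inj₂ i
halve : EGraph → EGraph
halve H = record
  { Vt   = Vt H ⊎ Fin (length (rest H))
  ; _≟V_ = SumP.≡-dec (_≟V_ H) Fin._≟_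
  ; u    = inj₁ (u H)
  ; v    = inj₁ (v H)
  ; rest = concatMap (λ i → (inj₁ (proj₁ (lookup (rest H) i)) , inj₂ i)
                          ∷ (inj₂ i , inj₁ (proj₂ (lookup (rest H) i))) ∷ [])
                     (allFin (length (rest H))) }

simplify : EGraph → EGraph
simplify H = halve (double H)

inj₁-≢ : {A B : Set} {x y : A} → x ≢ y → _≢_ {A = A ⊎ B} (inj₁ x) (inj₁ y)
inj₁-≢ p refl = p refl

SameEnds : {V : Set} → V × V → V × V → Set
SameEnds p q = p ≡ q ⊎ p ≡ swap q

Simple : Graph → Set
Simple G = (∀ (i : EdgeIx G) → proj₁ (lookup (edges G) i) ≢ proj₂ (lookup (edges G) i))
         × (∀ (i j : EdgeIx G) → i ≢ j → ¬ SameEnds (lookup (edges G) i) (lookup (edges G) j))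

-- Bridges: e is a bridge of H if deleting it disconnects its ends
-- (equivalently, increases the number of components).

IsBridge : EGraph → Set
IsBridge H = ¬ Walk (deleteE H) fullSet (u H) (v H)

-- Planarity (combinatorial): a graph with vertex set Fin n is planar iff
-- it has a rotation system of genus 0, i.e. (for connected graphs)
-- n - m + F = 2 where F is the number of faces (orbits of σ ∘ θ).

Dart : Graph → Set
Dart G = EdgeIx G × Bool

tailD : (G : Graph) → Dart G → V G
tailD G (i , true)  = proj₁ (lookup (edges G) i)
tailD G (i , false) = proj₂ (lookup (edges G) i)

θ : {G : Graph} → Dart G → Dart G
θ (i , b) = i , not b

iter : {A : Set} → (A → A) → ℕ → A → A
iter f zero    x = x
iter f (suc k) x = f (iter f k x)

SameOrbit : {A : Set} → (A → A) → A → A → Set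
SameOrbit f a b = Σ[ k ∈ ℕ ] iter f k a ≡ b

NumOrbits : {A : Set} → (A → A) → ℕ → Set
NumOrbits {A} f F = Σ[ L ∈ List A ] (length L ≡ F
  × (∀ a → Any (λ r → SameOrbit f r a) L)
  × (∀ (i j : Fin (length L)) → i ≢ j → ¬ SameOrbit f (lookup L i) (lookup L j)))

record RotationSystem (G : Graph) : Set where
  field
    σ σ⁻¹   : Dart G → Dart G
    σσ⁻¹    : ∀ d → σ (σ⁻¹ d) ≡ d
    σ⁻¹σ    : ∀ d → σ⁻¹ (σ d) ≡ d
    σ-tail  : ∀ d → tailD G (σ d) ≡ tailD G d
    σ-cyclic : ∀ d d′ → tailD G d ≡ tailD G d′ → SameOrbit σ d d′

Planar : (n : ℕ) (E : List (Fin n × Fin n)) → Set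
Planar n E = Σ[ ρ ∈ RotationSystem G ] Σ[ F ∈ ℕ ]
    (NumOrbits (RotationSystem.σ ρ ∘ θ {G}) F × n + F ≡ 2 + length E)
  where
    G : Graph
    G = record { V = Fin n ; edges = E }

baseEG : (n : ℕ) (a b : Fin n) (es : List (Fin n × Fin n)) → EGraph
baseEG n a b es = record { Vt = Fin n ; _≟V_ = Fin._≟_ ; u = a ; v = b ; rest = es }

{-# OPTIONS --safe #-}

-- Spanning trees of G − e have |V| − 1 edges and those of G / e have |V| − 2.
-- A spanning tree of the doubled graph is a spanning tree S of the original
-- graph together with a choice of one of the two copies of each edge of S, so
-- doubling multiplies τ(G − e) by 2^(|V|−1) and τ(G / e) by 2^(|V|−2).  A spanning
-- tree of the subdivided graph consists of both halves of the edges of a spanning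
-- tree S and one of the two halves of each of the remaining edges, so with m edges
-- other than e:  2^(|V|−1) τ(G'' − e) = 2^m τ(G − e)  and  2^(|V|−2) τ(G'' / e) = 2^m τ(G / e).
-- Since G is simple, no edge other than e becomes a loop in G / e, so contracting e
-- commutes with doubling and subdividing.

module Submission where

open import Defs

open import Data.Bool using (Bool; true; false; _∨_; _∧_; not; if_then_else_)
open import Data.Bool.Properties using (∨-zeroʳ)
open import Data.Empty using (⊥; ⊥-elim)
open import Data.Fin using (Fin; zero; suc)
import Data.Fin as Fin
import Data.Fin.Properties as Finₚ
open import Data.Fin.Subset using (Subset; ∣_∣; ∁; _-_; _─_; Nonempty; Empty; inside; outside)
  renaming (_∈_ to _∈ₛ_; _∉_ to _∉ₛ_)
open import Data.Fin.Subset.Properties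
  using (∣∁p∣≡n∸∣p∣; ∣p∣≤n; p─⊥≡p; x∉⁅y⁆⇒x≢y; nonempty?; Empty-unique; ∣⊥∣≡0; _∈?_; x∈p∧x≢y⇒x∈p-y; p─q⊆p)
open import Data.List using (List; []; _∷_; _++_; length; lookup; map; filter; concatMap; cartesianProductWith; tabulate; allFin)
import Data.List.Properties as List
open import Data.List.Membership.Propositional using (_∈_; _∉_; find; lose)
open import Data.List.Membership.Propositional.Properties
  using (∈-allFin; ∈-map⁻; ∈-cartesianProductWith⁺; ∈-cartesianProductWith⁻; ∈-filter⁺; ∈-filter⁻; ∈-concatMap⁺; ∈-concatMap⁻; ∈-++⁺ˡ; ∈-length)
open import Data.List.Membership.Propositional.Properties.WithK using (unique∧set⇒bag)
open import Data.List.Relation.Binary.BagAndSetEquality using (∼bag⇒↭)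
open import Data.List.Relation.Binary.Permutation.Propositional.Properties using (↭-length)
open import Data.List.Relation.Unary.All as All using (All; []; _∷_)
import Data.List.Relation.Unary.All.Properties as Allₚ
import Data.List.Relation.Unary.AllPairs as AllPairs
import Data.List.Relation.Unary.AllPairs.Properties as AllPairsₚ
open import Data.List.Relation.Unary.Any using (here; there)
open import Data.List.Relation.Unary.Unique.Propositional using (Unique)
import Data.List.Relation.Unary.Unique.Propositional.Properties as Uniqueₚ
open import Data.Nat using (ℕ; NonZero; zero; suc; _+_; _*_; _^_; _≤_; z≤n; s≤s)
open import Data.Nat.Properties
  using (≤-refl; ≤-trans; ≤-antisym; 1+n≰n; +-suc; +-comm; suc-injective; *-identityˡ; *-zeroʳ; *-suc; *-distribˡ-+;
         *-cancelˡ-≡; m*n≢0; m^n≢0; ^-distribˡ-+-*; m+[n∸m]≡n)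
open import Data.Nat.Tactic.RingSolver using (solve-∀)
open import Data.Product using (Σ-syntax; ∃; _×_; _,_; proj₁; proj₂; uncurry)
open import Data.Sum using (_⊎_; inj₁; inj₂; [_,_]′)
import Data.Sum as Sum
import Data.Sum.Properties as Sumₚ
open import Data.Vec using ([]; _∷_; here; there)
import Data.Vec as Vec
import Data.Vec.Properties as Vecₚ
open import Function using (_∘_; id)
open import Function.Bundles using (_⇔_; mk⇔)
open import Relation.Binary.Definitions using (DecidableEquality)
open import Relation.Binary.PropositionalEquality using (_≡_; _≢_; refl; sym; trans; cong; cong₂; subst; module ≡-Reasoning)
open import Relation.Nullary using (¬_; Dec; yes; no; ¬?)
open import Relation.Nullary.Decidable using (_×-dec_; _⊎-dec_; False; fromWitnessFalse; toWitnessFalse)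
import Relation.Nullary.Decidable as Dec

module _ {A : Set} where

  Unique-∷ : ∀ {x xs} → x ∉ xs → Unique xs → Unique {A = A} (x ∷ xs)
  Unique-∷ {xs = xs} x∉xs u = Allₚ.¬Any⇒All¬ xs x∉xs AllPairs.∷ u

module _ {A B : Set} {P : A → Set} (f : A → B)
         (injective : ∀ {a b} → P a → P b → f a ≡ f b → a ≡ b) where

  Unique-map⁺ : ∀ {xs} → All P xs → Unique xs → Unique (map f xs)
  Unique-map⁺ [] AllPairs.[] = AllPairs.[]
  Unique-map⁺ (pa ∷ ps) (a∉ AllPairs.∷ u) =
    Allₚ.map⁺ (All.map (λ (a≢b , pb) e → a≢b (injective pa pb e)) (All.zip (a∉ , ps)))
      AllPairs.∷ Unique-map⁺ ps u

module Without {A : Set} (_≟_ : DecidableEquality A) where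

  _without_ : List A → A → List A
  xs without x = filter (λ y → ¬? (y ≟ x)) xs

  length-without : ∀ {x xs} → Unique xs → x ∈ xs → suc (length (xs without x)) ≡ length xs
  length-without {x} {.x ∷ ys} (x∉ys AllPairs.∷ _) (here refl) = cong suc (begin
    length ((x ∷ ys) without x) ≡⟨ cong length (List.filter-reject (λ y → ¬? (y ≟ x)) (λ x≢x → x≢x refl)) ⟩
    length (ys without x)       ≡⟨ cong length (List.filter-all (λ y → ¬? (y ≟ x))
                                                  (All.map (λ x≢y y≡x → x≢y (sym y≡x)) x∉ys)) ⟩
    length ys                   ∎)
    where open ≡-Reasoning
  length-without {x} {y ∷ ys} (y∉ys AllPairs.∷ u) (there x∈ys) =
    cong suc (trans (cong length (List.filter-accept (λ z → ¬? (z ≟ x)) y≢x)) (length-without u x∈ys))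
    where y≢x : y ≢ x
          y≢x refl = Allₚ.All¬⇒¬Any y∉ys x∈ys

  Unique-⊆⇒length≤ : ∀ {xs ys} → Unique xs → Unique ys → (∀ {v} → v ∈ xs → v ∈ ys) → length xs ≤ length ys
  Unique-⊆⇒length≤ {[]} _ _ _ = z≤n
  Unique-⊆⇒length≤ {x ∷ xs} {ys} (x∉xs AllPairs.∷ uxs) uys xs⊆ys =
    subst (suc (length xs) ≤_) (length-without uys (xs⊆ys (here refl)))
      (s≤s (Unique-⊆⇒length≤ uxs (Uniqueₚ.filter⁺ _ uys) xs⊆ys-x))
    where xs⊆ys-x : ∀ {v} → v ∈ xs → v ∈ ys without x
          xs⊆ys-x v∈xs = ∈-filter⁺ _ (xs⊆ys (there v∈xs)) (λ { refl → Allₚ.All¬⇒¬Any x∉xs v∈xs })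

Unique-++⁻ˡ : {A : Set} (xs : List A) {ys : List A} → Unique (xs ++ ys) → Unique xs
Unique-++⁻ˡ []       _                 = AllPairs.[]
Unique-++⁻ˡ (x ∷ xs) (x∉ AllPairs.∷ u) = Allₚ.++⁻ˡ xs x∉ AllPairs.∷ Unique-++⁻ˡ xs u

Unique-++⇒∉ : {A : Set} (xs : List A) {ys : List A} {v : A} → Unique (xs ++ ys) → v ∈ ys → v ∉ xs
Unique-++⇒∉ (x ∷ xs) (x∉ AllPairs.∷ _) v∈ys (here refl)  = Allₚ.All¬⇒¬Any (Allₚ.++⁻ʳ xs x∉) v∈ys
Unique-++⇒∉ (x ∷ xs) (_ AllPairs.∷ u)  v∈ys (there v∈xs) = Unique-++⇒∉ xs u v∈ys v∈xs

HasCount-functional : {A : Set} {P : A → Set} {t t′ : ℕ} → HasCount P t → HasCount P t′ → t ≡ t′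
HasCount-functional (L , uL , refl , L⊆P , P⊆L) (L′ , uL′ , refl , L′⊆P , P⊆L′) =
  ↭-length (∼bag⇒↭ (unique∧set⇒bag uL uL′ sameElements))
  where
    sameElements : ∀ {a} → a ∈ L ⇔ a ∈ L′
    sameElements = mk⇔ (λ a∈L → P⊆L′ _ (L⊆P _ a∈L)) (λ a∈L′ → P⊆L _ (L′⊆P _ a∈L′))

module _ {A B : Set} {P : A → Set} {Q : B → Set} (lifts : A → List B) (base : B → A)
         (Unique-lifts : ∀ a → Unique (lifts a))
         (base-lifts : ∀ {a b} → b ∈ lifts a → base b ≡ a)
         (lifts⇒Q : ∀ {a b} → P a → b ∈ lifts a → Q b)
         (Q⇒lifts : ∀ {b} → Q b → P (base b) × b ∈ lifts (base b)) where

  private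
    length-concatMap : ∀ k c → (∀ {a} → P a → k * length (lifts a) ≡ c) →
                       ∀ {L} → All P L → k * length (concatMap lifts L) ≡ c * length L
    length-concatMap k c _ [] = trans (*-zeroʳ k) (sym (*-zeroʳ c))
    length-concatMap k c fibre {a ∷ L} (pa ∷ pL) = begin
      k * length (lifts a ++ concatMap lifts L)                ≡⟨ cong (k *_) (List.length-++ (lifts a)) ⟩
      k * (length (lifts a) + length (concatMap lifts L))      ≡⟨ *-distribˡ-+ k _ _ ⟩
      k * length (lifts a) + k * length (concatMap lifts L)    ≡⟨ cong₂ _+_ (fibre pa) (length-concatMap k c fibre pL) ⟩
      c + c * length L                                         ≡⟨ sym (*-suc c (length L)) ⟩
      c * suc (length L)                                       ∎
      where open ≡-Reasoning

  -- each fibre has  c / k  elements; stating this as  k * size ≡ c  avoids division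
  HasCount-lifts : ∀ {t} k c → (∀ {a} → P a → k * length (lifts a) ≡ c) → HasCount P t →
                   Σ[ t′ ∈ ℕ ] (HasCount Q t′ × k * t′ ≡ c * t)
  HasCount-lifts k c fibre (L , uL , refl , L⊆P , P⊆L) =
    length (concatMap lifts L) ,
    (concatMap lifts L , unique , refl , sound , complete) ,
    length-concatMap k c fibre (All.tabulate (L⊆P _))
    where
      disjoint : ∀ {a a′} → a ≢ a′ → ∀ {b} → ¬ (b ∈ lifts a × b ∈ lifts a′)
      disjoint a≢a′ (b∈ , b∈′) = a≢a′ (trans (sym (base-lifts b∈)) (base-lifts b∈′))
      unique : Unique (concatMap lifts L)
      unique = Uniqueₚ.concat⁺ (Allₚ.map⁺ (All.universal Unique-lifts L))
                              (AllPairsₚ.map⁺ (AllPairs.map disjoint uL))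
      sound : ∀ b → b ∈ concatMap lifts L → Q b
      sound b b∈ with find (∈-concatMap⁻ lifts b∈)
      ... | a , a∈L , b∈lifts = lifts⇒Q (L⊆P a a∈L) b∈lifts
      complete : ∀ b → Q b → b ∈ concatMap lifts L
      complete b qb = ∈-concatMap⁺ lifts (lose (P⊆L _ (proj₁ (Q⇒lifts qb))) (proj₂ (Q⇒lifts qb)))

∣p∣+∣∁p∣≡n : ∀ {n} (p : Subset n) → ∣ p ∣ + ∣ ∁ p ∣ ≡ n
∣p∣+∣∁p∣≡n p = trans (cong (∣ p ∣ +_) (∣∁p∣≡n∸∣p∣ p)) (m+[n∸m]≡n (∣p∣≤n p))

x∈p─q⇒x∉q : ∀ {n} {p q : Subset n} {x} → x ∈ₛ p ─ q → x ∉ₛ q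
x∈p─q⇒x∉q {p = _ ∷ _} {inside  ∷ _} {zero}  ()
x∈p─q⇒x∉q {p = _ ∷ _} {outside ∷ _} {zero}  _          ()
x∈p─q⇒x∉q {p = _ ∷ _} {_ ∷ _}       {suc x} (there x∈) (there x∈q) = x∈p─q⇒x∉q x∈ x∈q

x∈p-y⇒x≢y : ∀ {n} {p : Subset n} {x y} → x ∈ₛ p - y → x ≢ y
x∈p-y⇒x≢y x∈ = x∉⁅y⁆⇒x≢y (x∈p─q⇒x∉q x∈)

x∈p⇒suc∣p-x∣≡∣p∣ : ∀ {n} {p : Subset n} {x} → x ∈ₛ p → suc ∣ p - x ∣ ≡ ∣ p ∣
x∈p⇒suc∣p-x∣≡∣p∣ {p = inside  ∷ p} {zero}  here       = cong (suc ∘ ∣_∣) (p─⊥≡p p)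
x∈p⇒suc∣p-x∣≡∣p∣ {p = inside  ∷ p} {suc x} (there x∈) = cong suc (x∈p⇒suc∣p-x∣≡∣p∣ x∈)
x∈p⇒suc∣p-x∣≡∣p∣ {p = outside ∷ p} {suc x} (there x∈) = x∈p⇒suc∣p-x∣≡∣p∣ x∈

∣p∣≡0⇒Empty : ∀ {n} {p : Subset n} → ∣ p ∣ ≡ 0 → Empty p
∣p∣≡0⇒Empty ∣p∣≡0 (x , x∈p) with () ← trans (x∈p⇒suc∣p-x∣≡∣p∣ x∈p) ∣p∣≡0

∣p∣≡suc⇒Nonempty : ∀ {n m} {p : Subset n} → ∣ p ∣ ≡ suc m → Nonempty p
∣p∣≡suc⇒Nonempty {n} {p = p} ∣p∣≡suc with nonempty? p
... | yes ne = ne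
... | no  e  with () ← trans (sym (trans (cong ∣_∣ (Empty-unique e)) (∣⊥∣≡0 n))) ∣p∣≡suc

Incident : {X : Set} → X × X → X → Set
Incident e x = proj₁ e ≡ x ⊎ proj₂ e ≡ x

module _ {X : Set} where

  Joins⇒Incidentˡ : (e : X × X) {x y : X} → Joins e x y → Incident e x
  Joins⇒Incidentˡ e (inj₁ (a≡x , _)) = inj₁ a≡x
  Joins⇒Incidentˡ e (inj₂ (_ , b≡x)) = inj₂ b≡x

  Joins⇒Incidentʳ : (e : X × X) {x y : X} → Joins e x y → Incident e y
  Joins⇒Incidentʳ e (inj₁ (_ , b≡y)) = inj₂ b≡y
  Joins⇒Incidentʳ e (inj₂ (a≡y , _)) = inj₁ a≡y

  Joins-sym : (e : X × X) {x y : X} → Joins e x y → Joins e y x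
  Joins-sym e = Sum.swap

  Incident⇒Joins : (e : X × X) {x : X} → Incident e x → ∃ (Joins e x)
  Incident⇒Joins (a , b) (inj₁ a≡x) = b , inj₁ (a≡x , refl)
  Incident⇒Joins (a , b) (inj₂ b≡x) = a , inj₂ (refl , b≡x)

  Joins-functional : (e : X × X) {x z z′ : X} → Joins e x z → Joins e x z′ → z ≡ z′
  Joins-functional (a , b) (inj₁ (refl , refl)) (inj₁ (refl , refl)) = refl
  Joins-functional (a , b) (inj₁ (refl , refl)) (inj₂ (refl , refl)) = refl
  Joins-functional (a , b) (inj₂ (refl , refl)) (inj₁ (refl , refl)) = refl
  Joins-functional (a , b) (inj₂ (refl , refl)) (inj₂ (refl , refl)) = refl

  Joins∧Incident⇒endpoint : (e : X × X) {x z v : X} → Joins e x z → Incident e v → v ≡ x ⊎ v ≡ z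
  Joins∧Incident⇒endpoint (a , b) (inj₁ (refl , refl)) (inj₁ refl) = inj₁ refl
  Joins∧Incident⇒endpoint (a , b) (inj₁ (refl , refl)) (inj₂ refl) = inj₂ refl
  Joins∧Incident⇒endpoint (a , b) (inj₂ (refl , refl)) (inj₁ refl) = inj₂ refl
  Joins∧Incident⇒endpoint (a , b) (inj₂ (refl , refl)) (inj₂ refl) = inj₁ refl

  Joins-other : (e : X × X) {ℓ p x z : X} → Joins e ℓ p → Joins e x z → x ≢ ℓ → x ≡ p × z ≡ ℓ
  Joins-other e ℓ-p x-z x≢ℓ with Joins∧Incident⇒endpoint e ℓ-p (Joins⇒Incidentˡ e x-z)
  ... | inj₁ x≡ℓ = ⊥-elim (x≢ℓ x≡ℓ)
  ... | inj₂ refl = refl , Joins-functional e x-z (Joins-sym e ℓ-p)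


module _ {G : Graph} {T : EdgeSet G} where

  _++ʷ_ : ∀ {x y z} → Walk G T x y → Walk G T y z → Walk G T x z
  []             ++ʷ w′ = w′
  step i i∈ j w  ++ʷ w′ = step i i∈ j (w ++ʷ w′)

  walkEdges-++ʷ : ∀ {x y z} (w : Walk G T x y) (w′ : Walk G T y z) →
                  walkEdges (w ++ʷ w′) ≡ walkEdges w ++ walkEdges w′
  walkEdges-++ʷ []             w′ = refl
  walkEdges-++ʷ (step i _ _ w) w′ = cong (i ∷_) (walkEdges-++ʷ w w′)

  walkVerts-++ʷ : ∀ {x y z} (w : Walk G T x y) (w′ : Walk G T y z) →
                  walkVerts (w ++ʷ w′) ≡ walkVerts w ++ walkVerts w′
  walkVerts-++ʷ []                       w′ = refl
  walkVerts-++ʷ {x = x} (step _ _ _ w) w′ = cong (x ∷_) (walkVerts-++ʷ w w′)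

  walkEdges⊆ : ∀ {x y} (w : Walk G T x y) → All (_∈ₛ T) (walkEdges w)
  walkEdges⊆ []              = []
  walkEdges⊆ (step _ i∈ _ w) = i∈ ∷ walkEdges⊆ w

  reverseʷ : ∀ {x y} → Walk G T x y → Walk G T y x
  reverseʷ []              = []
  reverseʷ (step i i∈ j w) = reverseʷ w ++ʷ step i i∈ (Joins-sym (lookup (edges G) i) j) []

CycleAt : (G : Graph) → EdgeSet G → V G → Set
CycleAt G T x = Σ[ w ∈ Walk G T x x ] (1 ≤ length (walkEdges w) × Unique (walkEdges w) × Unique (walkVerts w))

rotateCycle : ∀ {G : Graph} {T : EdgeSet G} {y₀ z k} (k∈ : k ∈ₛ T) (j : Joins (lookup (edges G) k) y₀ z)
              (w : Walk G T z y₀) → Unique (k ∷ walkEdges w) → Unique (y₀ ∷ walkVerts w) → CycleAt G T z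
rotateCycle {k = k} k∈ j w uE uV =
  w ++ʷ step k k∈ j [] ,
  subst (λ es → 1 ≤ length es) (sym (walkEdges-++ʷ w _))
    (subst (1 ≤_) (sym (List.length-++ (walkEdges w))) (subst (1 ≤_) (+-comm 1 _) (s≤s z≤n))) ,
  subst Unique (sym (walkEdges-++ʷ w _)) (Uniqueₚ.++⁺ (AllPairs.tail uE) (Unique-∷ (λ ()) AllPairs.[])
    (λ { (k∈w , here refl) → Allₚ.All¬⇒¬Any (AllPairs.head uE) k∈w })) ,
  subst Unique (sym (walkVerts-++ʷ w _)) (Uniqueₚ.++⁺ (AllPairs.tail uV) (Unique-∷ (λ ()) AllPairs.[])
    (λ { (y₀∈w , here refl) → Allₚ.All¬⇒¬Any (AllPairs.head uV) y₀∈w }))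

module WalkMap {G H : Graph} {T : EdgeSet G} {U : EdgeSet H}
  (φ : V G → V H) (ψ : EdgeIx G → EdgeIx H) (ψ-∈ : ∀ {i} → i ∈ₛ T → ψ i ∈ₛ U)
  (ψ-joins : ∀ {i x y} → i ∈ₛ T → Joins (lookup (edges G) i) x y →
             Joins (lookup (edges H) (ψ i)) (φ x) (φ y)) where

  mapWalk : ∀ {x y} → Walk G T x y → Walk H U (φ x) (φ y)
  mapWalk []              = []
  mapWalk (step i i∈ j w) = step (ψ i) (ψ-∈ i∈) (ψ-joins i∈ j) (mapWalk w)

  walkEdges-mapWalk : ∀ {x y} (w : Walk G T x y) → walkEdges (mapWalk w) ≡ map ψ (walkEdges w)
  walkEdges-mapWalk []             = refl
  walkEdges-mapWalk (step i _ _ w) = cong (ψ i ∷_) (walkEdges-mapWalk w)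

  walkVerts-mapWalk : ∀ {x y} (w : Walk G T x y) → walkVerts (mapWalk w) ≡ map φ (walkVerts w)
  walkVerts-mapWalk []                       = refl
  walkVerts-mapWalk {x = x} (step _ _ _ w) = cong (φ x ∷_) (walkVerts-mapWalk w)

  mapCycle : (∀ {a b} → φ a ≡ φ b → a ≡ b) → (∀ {i k} → i ∈ₛ T → k ∈ₛ T → ψ i ≡ ψ k → i ≡ k) →
             Cycle G T → Cycle H U
  mapCycle φ-injective ψ-injective (x , w , nonempty , uniqueEdges , uniqueVerts) =
    φ x , mapWalk w ,
    subst (λ es → 1 ≤ length es) (sym (walkEdges-mapWalk w))
      (subst (1 ≤_) (sym (List.length-map ψ (walkEdges w))) nonempty) ,
    subst Unique (sym (walkEdges-mapWalk w)) (Unique-map⁺ ψ ψ-injective (walkEdges⊆ w) uniqueEdges) ,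
    subst Unique (sym (walkVerts-mapWalk w)) (Uniqueₚ.map⁺ φ-injective uniqueVerts)

loop⇒Cycle : ∀ {G : Graph} {F : EdgeSet G} {k x} → k ∈ₛ F → Joins (lookup (edges G) k) x x → Cycle G F
loop⇒Cycle {k = k} {x} k∈F j = x , step k k∈F j [] , s≤s z≤n , Unique-∷ (λ ()) AllPairs.[] , Unique-∷ (λ ()) AllPairs.[]

Cycle-mono : ∀ {G : Graph} {T U : EdgeSet G} → (∀ {i} → i ∈ₛ T → i ∈ₛ U) → Cycle G T → Cycle G U
Cycle-mono {G} T⊆U = mapCycle id (λ _ _ → id)
  where open WalkMap {G} {G} id id T⊆U (λ _ j → j)

-- Size of spanning trees

module TreeSize (G : Graph) (_≟_ : DecidableEquality (V G))
                (vs : List (V G)) (vs-unique : Unique vs) (vs-complete : ∀ x → x ∈ vs) where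

  open import Data.List.Membership.DecPropositional _≟_ using () renaming (_∈?_ to _∈ᵥ?_)
  open Without _≟_

  private
    E = edges G

  IncidentTo : EdgeIx G → V G → Set
  IncidentTo k = Incident (lookup E k)

  incident? : ∀ k x → Dec (IncidentTo k x)
  incident? k x = (proj₁ (lookup E k) ≟ x) ⊎-dec (proj₂ (lookup E k) ≟ x)

  IsLeaf : EdgeSet G → V G → EdgeIx G → Set
  IsLeaf F ℓ j = j ∈ₛ F × IncidentTo j ℓ × (∀ {k} → k ∈ₛ F → IncidentTo k ℓ → k ≡ j)

  visited : ∀ {T : EdgeSet G} {x y} → Walk G T x y → List (V G)
  visited {x = x} []             = x ∷ []
  visited {x = x} (step _ _ _ w) = x ∷ visited w

  start∈visited : ∀ {T : EdgeSet G} {x y} (w : Walk G T x y) → x ∈ visited w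
  start∈visited []             = here refl
  start∈visited (step _ _ _ w) = here refl

  incident⇒visited : ∀ {T : EdgeSet G} {x y k v} (w : Walk G T x y) →
                     k ∈ walkEdges w → IncidentTo k v → v ∈ visited w
  incident⇒visited (step k _ j w) (here refl) k-v with Joins∧Incident⇒endpoint (lookup E k) j k-v
  ... | inj₁ refl = here refl
  ... | inj₂ refl = there (start∈visited w)
  incident⇒visited (step _ _ _ w) (there k∈w) k-v = there (incident⇒visited w k∈w k-v)

  splitAt : ∀ {T : EdgeSet G} {x y v} (w : Walk G T x y) → v ∈ visited w →
            Σ[ w₁ ∈ Walk G T x v ] Σ[ w₂ ∈ Walk G T v y ]
              (walkEdges w ≡ walkEdges w₁ ++ walkEdges w₂ × visited w ≡ walkVerts w₁ ++ visited w₂)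
  splitAt []             (here refl) = [] , [] , refl , refl
  splitAt (step i i∈ j w) (here refl) = [] , step i i∈ j w , refl , refl
  splitAt {x = x} (step i i∈ j w) (there v∈w) with splitAt w v∈w
  ... | w₁ , w₂ , edges≡ , visited≡ = step i i∈ j w₁ , w₂ , cong (i ∷_) edges≡ , cong (x ∷_) visited≡

  module FindLeaf (F : EdgeSet G) (acyclic : ¬ Cycle G F) where

    Leaf : Set
    Leaf = Σ[ ℓ ∈ V G ] Σ[ j ∈ EdgeIx G ] IsLeaf F ℓ j

    record Path : Set where
      constructor path
      field
        x z y       : V G
        k           : EdgeIx G
        k∈F         : k ∈ₛ F
        k-joins     : Joins (lookup E k) x z
        tail        : Walk G F z y
        uniqueVerts : Unique (x ∷ visited tail)
        uniqueEdges : Unique (k ∷ walkEdges tail)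

    size : Path → ℕ
    size p = length (visited (Path.tail p))

    closeCycle : ∀ {x z y z′ k k′} → k ∈ₛ F → Joins (lookup E k) x z → (w : Walk G F z y) →
                 Unique (x ∷ visited w) → Unique (k ∷ walkEdges w) →
                 k′ ∈ₛ F → k′ ∉ k ∷ walkEdges w → Joins (lookup E k′) z′ x → z′ ∈ visited w → Cycle G F
    closeCycle {x} {z′ = z′} {k} {k′} k∈F k-joins w uV uE k′∈F k′∉ k′-joins z′∈w with splitAt w z′∈w
    ... | w₁ , w₂ , edges≡ , visited≡ =
      z′ , step k′ k′∈F k′-joins (step k k∈F k-joins w₁) , s≤s z≤n , uniqueEdges , uniqueVerts
      where
        uE′ : Unique ((k ∷ walkEdges w₁) ++ walkEdges w₂)
        uE′ = subst (λ es → Unique (k ∷ es)) edges≡ uE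
        uV′ : Unique ((x ∷ walkVerts w₁) ++ visited w₂)
        uV′ = subst (λ us → Unique (x ∷ us)) visited≡ uV
        uniqueEdges : Unique (k′ ∷ k ∷ walkEdges w₁)
        uniqueEdges = Unique-∷ (λ k′∈ → k′∉ (subst (k′ ∈_) (sym (cong (k ∷_) edges≡)) (∈-++⁺ˡ k′∈)))
                               (Unique-++⁻ˡ (k ∷ walkEdges w₁) uE′)
        uniqueVerts : Unique (z′ ∷ x ∷ walkVerts w₁)
        uniqueVerts = Unique-∷ (Unique-++⇒∉ (x ∷ walkVerts w₁) uV′ (start∈visited w₂))
                               (Unique-++⁻ˡ (x ∷ walkVerts w₁) uV′)

    extend : ∀ {x z y k k′} (k∈F : k ∈ₛ F) (k-joins : Joins (lookup E k) x z) (w : Walk G F z y)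
             (uV : Unique (x ∷ visited w)) (uE : Unique (k ∷ walkEdges w)) →
             k′ ∈ₛ F → k′ ∉ k ∷ walkEdges w → IncidentTo k′ x →
             Σ[ p′ ∈ Path ] size p′ ≡ suc (length (visited w))
    extend {x} {y = y} {k} {k′} k∈F k-joins w uV uE k′∈F k′∉ k′-x with Incident⇒Joins (lookup E k′) k′-x
    ... | z′ , k′-joins with z′ ∈ᵥ? (x ∷ visited w)
    ...   | no z′∉ = path z′ x y k′ k′∈F (Joins-sym (lookup E k′) k′-joins) (step k k∈F k-joins w)
                          (Unique-∷ z′∉ uV) (Unique-∷ k′∉ uE) , refl
    ...   | yes (here z′≡x) =
      ⊥-elim (acyclic (loop⇒Cycle k′∈F (subst (Joins (lookup E k′) x) z′≡x k′-joins)))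
    ...   | yes (there z′∈w) =
      ⊥-elim (acyclic (closeCycle k∈F k-joins w uV uE k′∈F k′∉ (Joins-sym (lookup E k′) k′-joins) z′∈w))

    grow : (p : Path) → Leaf ⊎ Σ[ p′ ∈ Path ] size p′ ≡ suc (size p)
    grow (path x z y k k∈F k-joins w uV uE)
      with Finₚ.any? (λ k′ → (k′ ∈? F) ×-dec (¬? (k′ Fin.≟ k)) ×-dec incident? k′ x)
    ... | no noOther = inj₁ (x , k , k∈F , Joins⇒Incidentˡ (lookup E k) k-joins , onlyEdge)
      where
        onlyEdge : ∀ {k′} → k′ ∈ₛ F → IncidentTo k′ x → k′ ≡ k
        onlyEdge {k′} k′∈F k′-x with k′ Fin.≟ k
        ... | yes k′≡k = k′≡k
        ... | no  k′≢k = ⊥-elim (noOther (k′ , k′∈F , k′≢k , k′-x))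
    ... | yes (k′ , k′∈F , k′≢k , k′-x) = inj₂ (extend k∈F k-joins w uV uE k′∈F k′∉ k′-x)
      where
        k′∉ : k′ ∉ k ∷ walkEdges w
        k′∉ (here k′≡k)  = k′≢k k′≡k
        k′∉ (there k′∈w) = Allₚ.All¬⇒¬Any (AllPairs.head uV) (incident⇒visited w k′∈w k′-x)

    -- a path never visits more than  length vs  vertices, so growing terminates
    growUntilLeaf : (fuel : ℕ) (p : Path) → suc (length vs) ≤ fuel + size p → Leaf
    growUntilLeaf fuel p bound with grow p
    ... | inj₁ leaf = leaf
    growUntilLeaf zero p bound | inj₂ _ =
      ⊥-elim (1+n≰n (≤-trans bound (Unique-⊆⇒length≤ (AllPairs.tail (Path.uniqueVerts p)) vs-unique
                                                      (λ {v} _ → vs-complete v))))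
    growUntilLeaf (suc fuel) p bound | inj₂ (p′ , grew) =
      growUntilLeaf fuel p′ (subst (suc (length vs) ≤_) (trans (sym (+-suc fuel (size p))) (cong (fuel +_) (sym grew))) bound)

    findLeaf : ∀ {j₀} → j₀ ∈ₛ F → Leaf
    findLeaf {j₀} j₀∈F with proj₁ (lookup E j₀) ≟ proj₂ (lookup E j₀)
    ... | yes a≡b = ⊥-elim (acyclic (loop⇒Cycle j₀∈F (inj₁ (refl , sym a≡b))))
    ... | no  a≢b = growUntilLeaf (length vs)
                      (path _ _ _ j₀ j₀∈F (inj₁ (refl , refl)) []
                            (Unique-∷ (λ { (here a≡b) → a≢b a≡b }) (Unique-∷ (λ ()) AllPairs.[]))
                            (Unique-∷ (λ ()) AllPairs.[]))
                      (subst (suc (length vs) ≤_) (+-comm 1 (length vs)) ≤-refl)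

  TreeOn : List (V G) → EdgeSet G → Set
  TreeOn W F = (∀ {k v} → k ∈ₛ F → IncidentTo k v → v ∈ W)
             × (∀ {x y} → x ∈ W → y ∈ W → Walk G F x y)
             × ¬ Cycle G F

  module PruneLeaf {F : EdgeSet G} {ℓ : V G} {j : EdgeIx G} (leaf : IsLeaf F ℓ j) (acyclic : ¬ Cycle G F) where

    private
      j∈F = proj₁ leaf
      onlyEdge = proj₂ (proj₂ leaf)

    neighbour : V G
    neighbour = proj₁ (Incident⇒Joins (lookup E j) (proj₁ (proj₂ leaf)))

    j-joins : Joins (lookup E j) ℓ neighbour
    j-joins = proj₂ (Incident⇒Joins (lookup E j) (proj₁ (proj₂ leaf)))

    neighbour≢ℓ : neighbour ≢ ℓ
    neighbour≢ℓ n≡ℓ = acyclic (loop⇒Cycle j∈F (subst (Joins (lookup E j) ℓ) n≡ℓ j-joins))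

    -- a walk between two vertices other than ℓ can only enter ℓ along j and leave along j again
    avoidLeaf : ∀ {x y} → Walk G F x y → x ≢ ℓ → y ≢ ℓ → Walk G (F - j) x y
    avoidLeaf [] _ _ = []
    avoidLeaf (step i i∈F i-joins w) x≢ℓ y≢ℓ with i Fin.≟ j
    ... | no i≢j = step i (x∈p∧x≢y⇒x∈p-y i∈F i≢j) i-joins (avoidLeaf w z≢ℓ y≢ℓ)
      where
        z≢ℓ : _ ≢ ℓ
        z≢ℓ refl = i≢j (onlyEdge i∈F (Joins⇒Incidentʳ (lookup E i) i-joins))
    avoidLeaf (step j _ j-x-z []) x≢ℓ y≢ℓ | yes refl =
      ⊥-elim (y≢ℓ (proj₂ (Joins-other (lookup E j) j-joins j-x-z x≢ℓ)))
    avoidLeaf {x} {y} (step j _ j-x-z (step i i∈F i-joins w)) x≢ℓ y≢ℓ | yes refl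
      with Joins-other (lookup E j) j-joins j-x-z x≢ℓ
    ... | x≡neighbour , refl with onlyEdge i∈F (Joins⇒Incidentˡ (lookup E i) i-joins)
    ...   | refl =
      subst (λ u → Walk G (F - j) u y) (trans back (sym x≡neighbour))
            (avoidLeaf w (λ u≡ℓ → neighbour≢ℓ (trans (sym back) u≡ℓ)) y≢ℓ)
      where back = Joins-functional (lookup E j) i-joins j-joins

    prune : ∀ {W} → TreeOn W F → TreeOn (W without ℓ) (F - j)
    prune {W} (ends , connected , _) = ends′ , connected′ , acyclic′
      where
        ends′ : ∀ {k v} → k ∈ₛ F - j → IncidentTo k v → v ∈ W without ℓ
        ends′ {k} k∈F-j k-v = ∈-filter⁺ _ (ends (p─q⊆p _ _ k∈F-j) k-v)
          (λ { refl → x∈p-y⇒x≢y k∈F-j (onlyEdge (p─q⊆p _ _ k∈F-j) k-v) })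
        connected′ : ∀ {x y} → x ∈ W without ℓ → y ∈ W without ℓ → Walk G (F - j) x y
        connected′ x∈ y∈ with ∈-filter⁻ _ x∈ | ∈-filter⁻ _ y∈
        ... | x∈W , x≢ℓ | y∈W , y≢ℓ = avoidLeaf (connected x∈W y∈W) x≢ℓ y≢ℓ
        acyclic′ : ¬ Cycle G (F - j)
        acyclic′ = acyclic ∘ Cycle-mono (p─q⊆p _ _)

    neighbour∈ : ∀ {W} → TreeOn W F → neighbour ∈ W without ℓ
    neighbour∈ (ends , _) = ∈-filter⁺ _ (ends j∈F (Joins⇒Incidentʳ (lookup E j) j-joins)) neighbour≢ℓ

  treeOn-size : ∀ N {F W x₀} → ∣ F ∣ ≡ N → TreeOn W F → Unique W → x₀ ∈ W → suc N ≡ length W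
  treeOn-size zero {F} {W} {x₀} ∣F∣≡0 (_ , connected , _) uW x₀∈W =
    ≤-antisym (∈-length x₀∈W) (Unique-⊆⇒length≤ uW (Unique-∷ (λ ()) AllPairs.[]) W⊆[x₀])
    where
      trivial : ∀ {x y} → Walk G F x y → x ≡ y
      trivial []              = refl
      trivial (step i i∈F _ _) = ⊥-elim (∣p∣≡0⇒Empty ∣F∣≡0 (i , i∈F))
      W⊆[x₀] : ∀ {v} → v ∈ W → v ∈ x₀ ∷ []
      W⊆[x₀] v∈W = here (sym (trivial (connected x₀∈W v∈W)))
  treeOn-size (suc N) {F} {W} ∣F∣≡ tree@(ends , _ , acyclic) uW _
    with FindLeaf.findLeaf F acyclic (proj₂ (∣p∣≡suc⇒Nonempty ∣F∣≡))
  ... | ℓ , j , leaf = begin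
    suc (suc N)                ≡⟨ cong suc (treeOn-size N ∣F-j∣≡ (prune tree) (Uniqueₚ.filter⁺ _ uW) (neighbour∈ tree)) ⟩
    suc (length (W without ℓ)) ≡⟨ length-without uW (ends (proj₁ leaf) (proj₁ (proj₂ leaf))) ⟩
    length W                   ∎
    where
      open ≡-Reasoning
      open PruneLeaf leaf acyclic
      ∣F-j∣≡ : ∣ F - j ∣ ≡ N
      ∣F-j∣≡ = suc-injective (trans (x∈p⇒suc∣p-x∣≡∣p∣ (proj₁ leaf)) ∣F∣≡)

  spanningTree-size : ∀ {T} → IsSpanningTree G T → V G → suc ∣ T ∣ ≡ length vs
  spanningTree-size {T} (connected , acyclic) x₀ =
    treeOn-size ∣ T ∣ refl ((λ {_} {v} _ _ → vs-complete v) , (λ {x} {y} _ _ → connected x y) , acyclic)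
                vs-unique (vs-complete x₀)

-- Replacing every edge by two edges

module _ {F : Set} where

  pairUp : (m : ℕ) → (Fin m → F × F) → List F
  pairUp zero    f = []
  pairUp (suc m) f = proj₁ (f zero) ∷ proj₂ (f zero) ∷ pairUp m (f ∘ suc)

  PairIx : (m : ℕ) → (Fin m → F × F) → Set
  PairIx m f = Fin (length (pairUp m f))

  first second : ∀ {m} (f : Fin m → F × F) → Fin m → PairIx m f
  first  f zero    = zero
  first  f (suc i) = suc (suc (first (f ∘ suc) i))
  second f zero    = suc zero
  second f (suc i) = suc (suc (second (f ∘ suc) i))

  origin : ∀ {m} (f : Fin m → F × F) → PairIx m f → Fin m
  origin {suc m} f zero          = zero
  origin {suc m} f (suc zero)    = zero
  origin {suc m} f (suc (suc k)) = suc (origin (f ∘ suc) k)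

  origin-first : ∀ {m} (f : Fin m → F × F) i → origin f (first f i) ≡ i
  origin-first f zero    = refl
  origin-first f (suc i) = cong suc (origin-first (f ∘ suc) i)

  origin-second : ∀ {m} (f : Fin m → F × F) i → origin f (second f i) ≡ i
  origin-second f zero    = refl
  origin-second f (suc i) = cong suc (origin-second (f ∘ suc) i)

  first≢second : ∀ {m} (f : Fin m → F × F) i i′ → first f i ≢ second f i′
  first≢second f zero    zero    ()
  first≢second f (suc i) (suc i′) eq = first≢second (f ∘ suc) i i′ (Finₚ.suc-injective (Finₚ.suc-injective eq))

  first-or-second : ∀ {m} (f : Fin m → F × F) k → k ≡ first f (origin f k) ⊎ k ≡ second f (origin f k)
  first-or-second {suc m} f zero          = inj₁ refl
  first-or-second {suc m} f (suc zero)    = inj₂ refl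
  first-or-second {suc m} f (suc (suc k)) with first-or-second (f ∘ suc) k
  ... | inj₁ k≡ = inj₁ (cong (λ k → Fin.suc (Fin.suc k)) k≡)
  ... | inj₂ k≡ = inj₂ (cong (λ k → Fin.suc (Fin.suc k)) k≡)

  lookup-first : ∀ {m} (f : Fin m → F × F) i → lookup (pairUp m f) (first f i) ≡ proj₁ (f i)
  lookup-first f zero    = refl
  lookup-first f (suc i) = lookup-first (f ∘ suc) i

  lookup-second : ∀ {m} (f : Fin m → F × F) i → lookup (pairUp m f) (second f i) ≡ proj₂ (f i)
  lookup-second f zero    = refl
  lookup-second f (suc i) = lookup-second (f ∘ suc) i

  pairAt : ∀ {m} (f : Fin m → F × F) → Subset (length (pairUp m f)) → Fin m → Bool × Bool
  pairAt f T i = Vec.lookup T (first f i) , Vec.lookup T (second f i)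

module _ {A F : Set} where

  concatMap-tabulate : ∀ {m} (f : A → F × F) (h : Fin m → A) →
                       concatMap (λ a → proj₁ (f a) ∷ proj₂ (f a) ∷ []) (tabulate h) ≡ pairUp m (f ∘ h)
  concatMap-tabulate {zero}  f h = refl
  concatMap-tabulate {suc m} f h = cong (λ es → proj₁ (f (h zero)) ∷ proj₂ (f (h zero)) ∷ es) (concatMap-tabulate f (h ∘ suc))

module _ {F F′ : Set} where

  map-pairUp : ∀ {m} (g : F → F′) (f : Fin m → F × F) →
               map g (pairUp m f) ≡ pairUp m (λ i → g (proj₁ (f i)) , g (proj₂ (f i)))
  map-pairUp {zero}  g f = refl
  map-pairUp {suc m} g f = cong (λ es → g (proj₁ (f zero)) ∷ g (proj₂ (f zero)) ∷ es) (map-pairUp g (f ∘ suc))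

All-pairUp : ∀ {F : Set} {P : F → Set} {m} {f : Fin m → F × F} →
             (∀ i → P (proj₁ (f i)) × P (proj₂ (f i))) → All P (pairUp m f)
All-pairUp {m = zero}  ok = []
All-pairUp {m = suc m} ok = proj₁ (ok zero) ∷ proj₂ (ok zero) ∷ All-pairUp (λ i → ok (suc i))

pairUp-cong : ∀ {F : Set} {m} {f f′ : Fin m → F × F} → (∀ i → f i ≡ f′ i) → pairUp m f ≡ pairUp m f′
pairUp-cong {m = zero}  eq = refl
pairUp-cong {m = suc m} eq =
  cong₂ (λ p es → proj₁ p ∷ proj₂ p ∷ es) (eq zero) (pairUp-cong (λ i → eq (suc i)))

pairUp-cast : ∀ {F : Set} {m m′} (eq : m′ ≡ m) (f : Fin m → F × F) → pairUp m f ≡ pairUp m′ (f ∘ Fin.cast eq)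
pairUp-cast refl f = pairUp-cong (λ i → cong f (sym (Finₚ.cast-is-id refl i)))

lookup-map : {A B : Set} (g : A → B) (xs : List A) (i : Fin (length (map g xs))) →
             lookup (map g xs) i ≡ g (lookup xs (Fin.cast (List.length-map g xs) i))
lookup-map g (x ∷ xs) zero    = refl
lookup-map g (x ∷ xs) (suc i) = lookup-map g xs i

length-cartesianProductWith : {A B C : Set} (g : A → B → C) (xs : List A) (ys : List B) →
                              length (cartesianProductWith g xs ys) ≡ length xs * length ys
length-cartesianProductWith g []       ys = refl
length-cartesianProductWith g (x ∷ xs) ys = begin
  length (map (g x) ys ++ cartesianProductWith g xs ys)          ≡⟨ List.length-++ (map (g x) ys) ⟩
  length (map (g x) ys) + length (cartesianProductWith g xs ys)  ≡⟨ cong₂ _+_ (List.length-map (g x) ys)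
                                                                      (length-cartesianProductWith g xs ys) ⟩
  length ys + length xs * length ys                              ∎
  where open ≡-Reasoning

∈ₛ⇒lookup : ∀ {n} {T : Subset n} {i} → i ∈ₛ T → Vec.lookup T i ≡ true
∈ₛ⇒lookup = Vecₚ.[]=⇒lookup

lookup⇒∈ₛ : ∀ {n} {T : Subset n} {i} → Vec.lookup T i ≡ true → i ∈ₛ T
lookup⇒∈ₛ {T = T} {i} = Vecₚ.lookup⇒[]= i T

-- lifts f S  lists the edge sets whose pattern  pairAt f T i  is one of  allowed (i ∈ S)  for every i
module Lifts {F : Set} (allowed : Bool → List (Bool × Bool)) (_∙_ : Bool → Bool → Bool) where

  private
    cons₂ : ∀ {n} → Bool × Bool → Subset n → Subset (suc (suc n))
    cons₂ (a , b) T = a ∷ b ∷ T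

  lifts : ∀ {m} (f : Fin m → F × F) → Subset m → List (Subset (length (pairUp m f)))
  lifts f []      = [] ∷ []
  lifts f (s ∷ S) = cartesianProductWith cons₂ (allowed s) (lifts (f ∘ suc) S)

  collapse : ∀ {m} (f : Fin m → F × F) → Subset (length (pairUp m f)) → Subset m
  collapse f T = Vec.tabulate (λ i → uncurry _∙_ (pairAt f T i))

  lookup-collapse : ∀ {m} (f : Fin m → F × F) T i → Vec.lookup (collapse f T) i ≡ uncurry _∙_ (pairAt f T i)
  lookup-collapse f T = Vecₚ.lookup∘tabulate (λ i → uncurry _∙_ (pairAt f T i))

  ∈-lifts⁻ : ∀ {m} {f : Fin m → F × F} {S T} → T ∈ lifts f S → ∀ i → pairAt f T i ∈ allowed (Vec.lookup S i)
  ∈-lifts⁻ {f = f} {s ∷ S} T∈ i with ∈-cartesianProductWith⁻ cons₂ (allowed s) (lifts (f ∘ suc) S) T∈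
  ∈-lifts⁻ {f = f} {s ∷ S} T∈ zero    | _ , _ , ab∈ , _ , refl = ab∈
  ∈-lifts⁻ {f = f} {s ∷ S} T∈ (suc i) | _ , _ , _ , T′∈ , refl = ∈-lifts⁻ {f = f ∘ suc} {S} T′∈ i

  ∈-lifts⁺ : ∀ {m} {f : Fin m → F × F} {S} T → (∀ i → pairAt f T i ∈ allowed (Vec.lookup S i)) → T ∈ lifts f S
  ∈-lifts⁺ {zero}          {S = []}    []          _  = here refl
  ∈-lifts⁺ {suc m} {f = f} {S = s ∷ S} (a ∷ b ∷ T) ok =
    ∈-cartesianProductWith⁺ cons₂ (ok zero) (∈-lifts⁺ {f = f ∘ suc} {S} T (λ i → ok (suc i)))

  Unique-lifts : (∀ s → Unique (allowed s)) → ∀ {m} (f : Fin m → F × F) S → Unique (lifts f S)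
  Unique-lifts _        f []      = Unique-∷ (λ ()) AllPairs.[]
  Unique-lifts unique f (s ∷ S) =
    Uniqueₚ.cartesianProductWith⁺ cons₂ cons₂-injective (unique s) (Unique-lifts unique (f ∘ suc) S)
    where
      cons₂-injective : ∀ {ab ab′ : Bool × Bool} {T T′ : Subset (length (pairUp _ (f ∘ suc)))} →
                        cons₂ ab T ≡ cons₂ ab′ T′ → ab ≡ ab′ × T ≡ T′
      cons₂-injective refl = refl , refl

  length-lifts : (w : Bool → Bool) → (∀ s → length (allowed s) ≡ (if w s then 2 else 1)) →
                 ∀ {m} (f : Fin m → F × F) S → length (lifts f S) ≡ 2 ^ ∣ Vec.map w S ∣
  length-lifts w len f []      = refl
  length-lifts w len f (s ∷ S) with w s | len s
  ... | true  | len-s = trans (length-cartesianProductWith cons₂ (allowed s) _)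
                              (cong₂ _*_ len-s (length-lifts w len (f ∘ suc) S))
  ... | false | len-s = trans (length-cartesianProductWith cons₂ (allowed s) _)
                              (trans (cong₂ _*_ len-s (length-lifts w len (f ∘ suc) S)) (*-identityˡ _))

  collapse-lifts : (∀ {s a b} → (a , b) ∈ allowed s → a ∙ b ≡ s) →
                   ∀ {m} {f : Fin m → F × F} {S T} → T ∈ lifts f S → collapse f T ≡ S
  collapse-lifts sound {f = f} {S} T∈ =
    trans (Vecₚ.tabulate-cong (λ i → sound (∈-lifts⁻ {f = f} {S} T∈ i))) (Vecₚ.tabulate∘lookup S)

  lifts-collapse : ∀ {m} {f : Fin m → F × F} T → (∀ i → pairAt f T i ∈ allowed (uncurry _∙_ (pairAt f T i))) →
                   T ∈ lifts f (collapse f T)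
  lifts-collapse {f = f} T ok =
    ∈-lifts⁺ {f = f} {collapse f T} T (λ i → subst (λ s → pairAt f T i ∈ allowed s) (sym (lookup-collapse f T i)) (ok i))

  ∈-collapse⁻ : ∀ {m} {f : Fin m → F × F} {T i} → i ∈ₛ collapse f T → uncurry _∙_ (pairAt f T i) ≡ true
  ∈-collapse⁻ {f = f} {T} {i} i∈ = trans (sym (lookup-collapse f T i)) (∈ₛ⇒lookup i∈)

  ∈-collapse⁺ : ∀ {m} {f : Fin m → F × F} {T i} → uncurry _∙_ (pairAt f T i) ≡ true → i ∈ₛ collapse f T
  ∈-collapse⁺ {f = f} {T} {i} eq = lookup⇒∈ₛ (trans (lookup-collapse f T i) eq)

-- Doubling every edge

doubleAllowed : Bool → List (Bool × Bool)
doubleAllowed true  = (true , false) ∷ (false , true) ∷ []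
doubleAllowed false = (false , false) ∷ []

doubleAllowed-∨ : ∀ {s a b} → (a , b) ∈ doubleAllowed s → a ∨ b ≡ s
doubleAllowed-∨ {true}  (here refl)         = refl
doubleAllowed-∨ {true}  (there (here refl)) = refl
doubleAllowed-∨ {false} (here refl)         = refl

doubleAllowed-¬both : ∀ {s a b} → (a , b) ∈ doubleAllowed s → ¬ (a ≡ true × b ≡ true)
doubleAllowed-¬both {true}  (here refl)         (_ , ())
doubleAllowed-¬both {true}  (there (here refl)) (() , _)
doubleAllowed-¬both {false} (here refl)         (() , _)

doubleAllowed-complete : ∀ a b → ¬ (a ≡ true × b ≡ true) → (a , b) ∈ doubleAllowed (a ∨ b)
doubleAllowed-complete true  true  ¬both = ⊥-elim (¬both (refl , refl))
doubleAllowed-complete true  false _     = here refl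
doubleAllowed-complete false true  _     = there (here refl)
doubleAllowed-complete false false _     = here refl

Unique-doubleAllowed : ∀ s → Unique (doubleAllowed s)
Unique-doubleAllowed true  = Unique-∷ (λ { (here ()) ; (there ()) }) (Unique-∷ (λ ()) AllPairs.[])
Unique-doubleAllowed false = Unique-∷ (λ ()) AllPairs.[]

length-doubleAllowed : ∀ s → length (doubleAllowed s) ≡ (if s then 2 else 1)
length-doubleAllowed true  = refl
length-doubleAllowed false = refl

-- A spanning tree of the doubled graph uses at most one copy of every edge
-- (two copies form a cycle), and forgetting which copy it uses gives a
-- spanning tree of the original graph.
module Doubled {X : Set} (xs : List (X × X)) where

  copies : Fin (length xs) → (X × X) × (X × X)
  copies i = lookup xs i , lookup xs i

  G G² : Graph
  G  = record { V = X ; edges = xs }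
  G² = record { V = X ; edges = pairUp (length xs) copies }

module Doubling {X : Set} (_≟_ : DecidableEquality X) (xs : List (X × X)) where

  open Doubled xs public

  private
    m = length xs

  open Lifts {X × X} doubleAllowed _∨_

  lookup-copy : ∀ k → lookup (pairUp m copies) k ≡ lookup xs (origin copies k)
  lookup-copy k with first-or-second copies k
  ... | inj₁ k≡ = trans (cong (lookup (pairUp m copies)) k≡) (lookup-first copies (origin copies k))
  ... | inj₂ k≡ = trans (cong (lookup (pairUp m copies)) k≡) (lookup-second copies (origin copies k))

  joins-first : ∀ {i x y} → Joins (lookup xs i) x y → Joins (lookup (pairUp m copies) (first copies i)) x y
  joins-first {i} {x} {y} = subst (λ e → Joins e x y) (sym (lookup-first copies i))

  joins-second : ∀ {i x y} → Joins (lookup xs i) x y → Joins (lookup (pairUp m copies) (second copies i)) x y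
  joins-second {i} {x} {y} = subst (λ e → Joins e x y) (sym (lookup-second copies i))

  BothCopies : EdgeSet G² → Fin m → Set
  BothCopies T i = first copies i ∈ₛ T × second copies i ∈ₛ T

  module _ (T : EdgeSet G²) where

    private
      S = collapse copies T

    both⇒Cycle : ∀ {i} → BothCopies T i → Cycle G² T
    both⇒Cycle {i} (first∈ , second∈) with proj₁ (lookup xs i) ≟ proj₂ (lookup xs i)
    ... | yes a≡b = loop⇒Cycle first∈ (joins-first (inj₁ (refl , sym a≡b)))
    ... | no a≢b = _ , step (first copies i) first∈ (joins-first (inj₁ (refl , refl)))
                         (step (second copies i) second∈ (joins-second (inj₂ (refl , refl))) []) , s≤s z≤n ,
                   Unique-∷ (λ { (here eq) → first≢second copies i i eq }) (Unique-∷ (λ ()) AllPairs.[]) ,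
                   Unique-∷ (λ { (here eq) → a≢b eq }) (Unique-∷ (λ ()) AllPairs.[])

    origin-∈ : ∀ {k} → k ∈ₛ T → origin copies k ∈ₛ S
    origin-∈ {k} k∈T with first-or-second copies k
    ... | inj₁ k≡ = ∈-collapse⁺ {f = copies} {T} {i}
                      (cong (_∨ Vec.lookup T (second copies i)) (∈ₛ⇒lookup (subst (_∈ₛ T) k≡ k∈T)))
      where i = origin copies k
    ... | inj₂ k≡ = ∈-collapse⁺ {f = copies} {T} {i}
                      (trans (cong (Vec.lookup T (first copies i) ∨_) (∈ₛ⇒lookup (subst (_∈ₛ T) k≡ k∈T))) (∨-zeroʳ _))
      where i = origin copies k

    origin-injective : (∀ i → ¬ BothCopies T i) →
                       ∀ {k k′} → k ∈ₛ T → k′ ∈ₛ T → origin copies k ≡ origin copies k′ → k ≡ k′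
    origin-injective noBoth {k} {k′} k∈ k′∈ eq with first-or-second copies k | first-or-second copies k′
    ... | inj₁ p | inj₁ q = trans p (trans (cong (first copies) eq) (sym q))
    ... | inj₂ p | inj₂ q = trans p (trans (cong (second copies) eq) (sym q))
    ... | inj₁ p | inj₂ q =
      ⊥-elim (noBoth _ (subst (_∈ₛ T) p k∈ , subst (_∈ₛ T) (trans q (cong (second copies) (sym eq))) k′∈))
    ... | inj₂ p | inj₁ q =
      ⊥-elim (noBoth _ (subst (_∈ₛ T) (trans q (cong (first copies) (sym eq))) k′∈ , subst (_∈ₛ T) p k∈))

    pick : Fin m → PairIx m copies
    pick i = if Vec.lookup T (first copies i) then first copies i else second copies i

    origin-pick : ∀ i → origin copies (pick i) ≡ i
    origin-pick i with Vec.lookup T (first copies i)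
    ... | true  = origin-first copies i
    ... | false = origin-second copies i

    pick-∈ : ∀ {i} → i ∈ₛ S → pick i ∈ₛ T
    pick-∈ {i} i∈S with Vec.lookup T (first copies i) in a≡ | ∈-collapse⁻ {f = copies} {T} i∈S
    ... | true  | _  = lookup⇒∈ₛ a≡
    ... | false | b≡ = lookup⇒∈ₛ b≡

    private
      module Down = WalkMap {G²} {G} {T} {S} id (origin copies) origin-∈
                      (λ {k} {x} {y} _ → subst (λ e → Joins e x y) (lookup-copy k))
      module Up = WalkMap {G} {G²} {S} {T} id pick pick-∈
                    (λ {i} {x} {y} _ → subst (λ e → Joins e x y)
                                         (sym (trans (lookup-copy (pick i)) (cong (lookup xs) (origin-pick i)))))

    tree⇒collapse : IsSpanningTree G² T → (∀ i → ¬ BothCopies T i) × IsSpanningTree G S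
    tree⇒collapse (connected , acyclic) =
      (λ i both → acyclic (both⇒Cycle both)) ,
      (λ x y → Down.mapWalk (connected x y)) ,
      acyclic ∘ Up.mapCycle id (λ {i} {i′} _ _ eq → trans (sym (origin-pick i)) (trans (cong (origin copies) eq) (origin-pick i′)))

    collapse⇒tree : (∀ i → ¬ BothCopies T i) → IsSpanningTree G S → IsSpanningTree G² T
    collapse⇒tree noBoth (connected , acyclic) =
      (λ x y → Up.mapWalk (connected x y)) ,
      acyclic ∘ Down.mapCycle id (origin-injective noBoth)

  lifts⇒tree : ∀ {S T} → IsSpanningTree G S → T ∈ lifts copies S → IsSpanningTree G² T
  lifts⇒tree {S} {T} treeS T∈ =
    collapse⇒tree T noBoth (subst (IsSpanningTree G) (sym (collapse-lifts doubleAllowed-∨ {f = copies} T∈)) treeS)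
    where
      noBoth : ∀ i → ¬ BothCopies T i
      noBoth i (first∈ , second∈) =
        doubleAllowed-¬both (∈-lifts⁻ {f = copies} {S} T∈ i) (∈ₛ⇒lookup first∈ , ∈ₛ⇒lookup second∈)

  tree⇒lifts : ∀ {T} → IsSpanningTree G² T → IsSpanningTree G (collapse copies T) × T ∈ lifts copies (collapse copies T)
  tree⇒lifts {T} treeT =
    proj₂ (tree⇒collapse T treeT) ,
    lifts-collapse {f = copies} T (λ i → doubleAllowed-complete _ _
      (λ (a , b) → proj₁ (tree⇒collapse T treeT) i (lookup⇒∈ₛ a , lookup⇒∈ₛ b)))

  spanningTrees-double : ∀ {t} s → (∀ {S} → IsSpanningTree G S → ∣ S ∣ ≡ s) →
                         HasCount (IsSpanningTree G) t → HasCount (IsSpanningTree G²) (2 ^ s * t)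
  spanningTrees-double s size τ
    with HasCount-lifts (lifts copies) (collapse copies) (Unique-lifts Unique-doubleAllowed copies)
                        (collapse-lifts doubleAllowed-∨) lifts⇒tree tree⇒lifts 1 (2 ^ s) fibre τ
    where
      fibre : ∀ {S} → IsSpanningTree G S → 1 * length (lifts copies S) ≡ 2 ^ s
      fibre {S} treeS = trans (*-identityˡ _)
        (trans (length-lifts id length-doubleAllowed copies S) (cong (2 ^_) (trans (cong ∣_∣ (Vecₚ.map-id S)) (size treeS))))
  ... | t′ , τ² , t′≡ = subst (HasCount (IsSpanningTree G²)) (trans (sym (*-identityˡ t′)) t′≡) τ²

-- Subdividing every edge

subdivideAllowed : Bool → List (Bool × Bool)
subdivideAllowed true  = (true , true) ∷ []
subdivideAllowed false = (true , false) ∷ (false , true) ∷ []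

subdivideAllowed-∧ : ∀ {s a b} → (a , b) ∈ subdivideAllowed s → a ∧ b ≡ s
subdivideAllowed-∧ {true}  (here refl)         = refl
subdivideAllowed-∧ {false} (here refl)         = refl
subdivideAllowed-∧ {false} (there (here refl)) = refl

subdivideAllowed-some : ∀ {s a b} → (a , b) ∈ subdivideAllowed s → a ≡ true ⊎ b ≡ true
subdivideAllowed-some {true}  (here refl)         = inj₁ refl
subdivideAllowed-some {false} (here refl)         = inj₁ refl
subdivideAllowed-some {false} (there (here refl)) = inj₂ refl

subdivideAllowed-complete : ∀ a b → a ≡ true ⊎ b ≡ true → (a , b) ∈ subdivideAllowed (a ∧ b)
subdivideAllowed-complete true  true  _         = here refl
subdivideAllowed-complete true  false _         = here refl
subdivideAllowed-complete false true  _         = there (here refl)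
subdivideAllowed-complete false false (inj₁ ())
subdivideAllowed-complete false false (inj₂ ())

Unique-subdivideAllowed : ∀ s → Unique (subdivideAllowed s)
Unique-subdivideAllowed true  = Unique-∷ (λ ()) AllPairs.[]
Unique-subdivideAllowed false = Unique-∷ (λ { (here ()) ; (there ()) }) (Unique-∷ (λ ()) AllPairs.[])

length-subdivideAllowed : ∀ s → length (subdivideAllowed s) ≡ (if not s then 2 else 1)
length-subdivideAllowed true  = refl
length-subdivideAllowed false = refl

∧≡true : ∀ {a b} → a ∧ b ≡ true → a ≡ true × b ≡ true
∧≡true {true} {true} refl = refl , refl

module Subdivided {X Y : Set} (ι : X → Y) (xs : List (X × X)) (mid : Fin (length xs) → Y) where

  end₁ end₂ : Fin (length xs) → X
  end₁ i = proj₁ (lookup xs i)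
  end₂ i = proj₂ (lookup xs i)

  halves : Fin (length xs) → (Y × Y) × (Y × Y)
  halves i = (ι (end₁ i) , mid i) , (mid i , ι (end₂ i))

  G G½ : Graph
  G  = record { V = X ; edges = xs }
  G½ = record { V = Y ; edges = pairUp (length xs) halves }

-- A spanning tree of the subdivided graph contains both halves of the edges of
-- a spanning tree S of the base graph and exactly one half of every other edge.
module Subdivision {X Y : Set} (ι : X → Y) (xs : List (X × X)) (mid : Fin (length xs) → Y)
  (ι-injective : ∀ {a b} → ι a ≡ ι b → a ≡ b) (mid-injective : ∀ {i j} → mid i ≡ mid j → i ≡ j)
  (ι≢mid : ∀ a i → ι a ≢ mid i) (ι-or-mid : ∀ y → (∃ λ x → y ≡ ι x) ⊎ (∃ λ i → y ≡ mid i)) where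

  open Subdivided ι xs mid public

  private
    m = length xs
    E½ = pairUp m halves
    first½ second½ : Fin m → PairIx m halves
    first½  = first halves
    second½ = second halves

  open Lifts {Y × Y} subdivideAllowed _∧_

  Half : Fin m → PairIx m halves → X → Set
  Half i k c = (k ≡ first½ i × c ≡ end₁ i) ⊎ (k ≡ second½ i × c ≡ end₂ i)

  half-joins : ∀ {i k c} → Half i k c → Joins (lookup E½ k) (ι c) (mid i)
  half-joins {i} (inj₁ (refl , refl)) =
    subst (λ e → Joins e (ι (end₁ i)) (mid i)) (sym (lookup-first halves i)) (inj₁ (refl , refl))
  half-joins {i} (inj₂ (refl , refl)) =
    subst (λ e → Joins e (ι (end₂ i)) (mid i)) (sym (lookup-second halves i)) (inj₂ (refl , refl))

  joins⇒half : ∀ {k y z} → Joins (lookup E½ k) y z →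
               Σ[ c ∈ X ] Half (origin halves k) k c ×
                 ((y ≡ ι c × z ≡ mid (origin halves k)) ⊎ (y ≡ mid (origin halves k) × z ≡ ι c))
  joins⇒half {k} {y} {z} j with first-or-second halves k
  ... | inj₁ k≡ with subst (λ e → Joins e y z) (trans (cong (lookup E½) k≡) (lookup-first halves _)) j
  ...   | inj₁ (y≡ , z≡) = _ , inj₁ (k≡ , refl) , inj₁ (sym y≡ , sym z≡)
  ...   | inj₂ (z≡ , y≡) = _ , inj₁ (k≡ , refl) , inj₂ (sym y≡ , sym z≡)
  joins⇒half {k} {y} {z} j | inj₂ k≡ with subst (λ e → Joins e y z) (trans (cong (lookup E½) k≡) (lookup-second halves _)) j
  ...   | inj₁ (y≡ , z≡) = _ , inj₂ (k≡ , refl) , inj₂ (sym y≡ , sym z≡)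
  ...   | inj₂ (z≡ , y≡) = _ , inj₂ (k≡ , refl) , inj₁ (sym y≡ , sym z≡)

  ¬joinsιι : ∀ {k a b} → ¬ Joins (lookup E½ k) (ι a) (ι b)
  ¬joinsιι j with joins⇒half j
  ... | _ , _ , inj₁ (_ , ιb≡mid) = ι≢mid _ _ ιb≡mid
  ... | _ , _ , inj₂ (ιa≡mid , _) = ι≢mid _ _ ιa≡mid

  module _ (T : EdgeSet G½) where

    private
      S = collapse halves T

    ∈S⇒both : ∀ {i} → i ∈ₛ S → first½ i ∈ₛ T × second½ i ∈ₛ T
    ∈S⇒both {i} i∈S with ∧≡true (∈-collapse⁻ {f = halves} {T} i∈S)
    ... | a≡ , b≡ = lookup⇒∈ₛ a≡ , lookup⇒∈ₛ b≡

    both⇒∈S : ∀ {i} → first½ i ∈ₛ T → second½ i ∈ₛ T → i ∈ₛ S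
    both⇒∈S first∈ second∈ = ∈-collapse⁺ {f = halves} {T} (cong₂ _∧_ (∈ₛ⇒lookup first∈) (∈ₛ⇒lookup second∈))

    two-halves : ∀ {i k k′ c c′} → Half i k c → Half i k′ c′ → k ≢ k′ → k ∈ₛ T → k′ ∈ₛ T →
                 i ∈ₛ S × Joins (lookup xs i) c c′ × (first½ i ≡ k ⊎ first½ i ≡ k′)
    two-halves (inj₁ (refl , _)) (inj₁ (refl , _)) k≢k′ _ _ = ⊥-elim (k≢k′ refl)
    two-halves (inj₂ (refl , _)) (inj₂ (refl , _)) k≢k′ _ _ = ⊥-elim (k≢k′ refl)
    two-halves (inj₁ (refl , refl)) (inj₂ (refl , refl)) _ k∈ k′∈ = both⇒∈S k∈ k′∈ , inj₁ (refl , refl) , inj₁ refl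
    two-halves (inj₂ (refl , refl)) (inj₁ (refl , refl)) _ k∈ k′∈ = both⇒∈S k′∈ k∈ , inj₂ (refl , refl) , inj₂ refl

    record Crossing (i : Fin m) (x z : X) : Set where
      field
        k₁ k₂   : PairIx m halves
        k₁∈T    : k₁ ∈ₛ T
        k₂∈T    : k₂ ∈ₛ T
        joins₁  : Joins (lookup E½ k₁) (ι x) (mid i)
        joins₂  : Joins (lookup E½ k₂) (mid i) (ι z)
        origin₁ : origin halves k₁ ≡ i
        origin₂ : origin halves k₂ ≡ i
        k₁≢k₂   : k₁ ≢ k₂

    crossing : ∀ {i x z} → i ∈ₛ S → Joins (lookup xs i) x z → Crossing i x z
    crossing {i} i∈S (inj₁ (refl , refl)) = record
      { k₁ = first½ i ; k₂ = second½ i ; k₁∈T = proj₁ (∈S⇒both i∈S) ; k₂∈T = proj₂ (∈S⇒both i∈S)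
      ; joins₁ = half-joins (inj₁ (refl , refl)) ; joins₂ = Joins-sym _ (half-joins (inj₂ (refl , refl)))
      ; origin₁ = origin-first halves i ; origin₂ = origin-second halves i ; k₁≢k₂ = first≢second halves i i }
    crossing {i} i∈S (inj₂ (refl , refl)) = record
      { k₁ = second½ i ; k₂ = first½ i ; k₁∈T = proj₂ (∈S⇒both i∈S) ; k₂∈T = proj₁ (∈S⇒both i∈S)
      ; joins₁ = half-joins (inj₂ (refl , refl)) ; joins₂ = Joins-sym _ (half-joins (inj₁ (refl , refl)))
      ; origin₁ = origin-second halves i ; origin₂ = origin-first halves i ; k₁≢k₂ = first≢second halves i i ∘ sym }

    expand : ∀ {x y} → Walk G S x y → Walk G½ T (ι x) (ι y)
    expand []               = []
    expand (step i i∈S j w) = step k₁ k₁∈T joins₁ (step k₂ k₂∈T joins₂ (expand w))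
      where open Crossing (crossing i∈S j)

    expand-edges : ∀ {x y} (w : Walk G S x y) {k} → k ∈ walkEdges (expand w) → origin halves k ∈ walkEdges w
    expand-edges (step i i∈S j w) (here refl)         = here (Crossing.origin₁ (crossing i∈S j))
    expand-edges (step i i∈S j w) (there (here refl)) = here (Crossing.origin₂ (crossing i∈S j))
    expand-edges (step i i∈S j w) (there (there k∈))  = there (expand-edges w k∈)

    expand-verts : ∀ {x y} (w : Walk G S x y) {v} → v ∈ walkVerts (expand w) →
                   (∃ λ x′ → v ≡ ι x′ × x′ ∈ walkVerts w) ⊎ (∃ λ i → v ≡ mid i × i ∈ walkEdges w)
    expand-verts {x} (step i _ _ w) (here refl)         = inj₁ (x , refl , here refl)
    expand-verts     (step i _ _ w) (there (here refl)) = inj₂ (i , refl , here refl)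
    expand-verts     (step i _ _ w) (there (there v∈)) with expand-verts w v∈
    ... | inj₁ (x′ , v≡ , x′∈) = inj₁ (x′ , v≡ , there x′∈)
    ... | inj₂ (i′ , v≡ , i′∈) = inj₂ (i′ , v≡ , there i′∈)

    expand-unique : ∀ {x y} (w : Walk G S x y) → Unique (walkEdges w) → Unique (walkVerts w) →
                    Unique (walkEdges (expand w)) × Unique (walkVerts (expand w))
    expand-unique []                   _  _  = AllPairs.[] , AllPairs.[]
    expand-unique {x} (step i i∈S j w) uE uV =
      Unique-∷ k₁∉ (Unique-∷ k₂∉ (proj₁ inner)) , Unique-∷ ιx∉ (Unique-∷ mid∉ (proj₂ inner))
      where
        open Crossing (crossing i∈S j)
        inner = expand-unique w (AllPairs.tail uE) (AllPairs.tail uV)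
        i∉ : i ∉ walkEdges w
        i∉ = Allₚ.All¬⇒¬Any (AllPairs.head uE)
        k₁∉ : k₁ ∉ k₂ ∷ walkEdges (expand w)
        k₁∉ (here k₁≡k₂) = k₁≢k₂ k₁≡k₂
        k₁∉ (there k₁∈)  = i∉ (subst (_∈ walkEdges w) origin₁ (expand-edges w k₁∈))
        k₂∉ : k₂ ∉ walkEdges (expand w)
        k₂∉ k₂∈ = i∉ (subst (_∈ walkEdges w) origin₂ (expand-edges w k₂∈))
        ιx∉ : ι x ∉ mid i ∷ walkVerts (expand w)
        ιx∉ (here ιx≡mid) = ι≢mid _ _ ιx≡mid
        ιx∉ (there ιx∈) with expand-verts w ιx∈
        ... | inj₁ (x′ , ιx≡ , x′∈) =
          Allₚ.All¬⇒¬Any (AllPairs.head uV) (subst (_∈ walkVerts w) (sym (ι-injective ιx≡)) x′∈)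
        ... | inj₂ (_ , ιx≡mid , _) = ι≢mid _ _ ιx≡mid
        mid∉ : mid i ∉ walkVerts (expand w)
        mid∉ mid∈ with expand-verts w mid∈
        ... | inj₁ (_ , mid≡ι , _)   = ι≢mid _ _ (sym mid≡ι)
        ... | inj₂ (i′ , mid≡ , i′∈) = i∉ (subst (_∈ walkEdges w) (sym (mid-injective mid≡)) i′∈)

    expandCycle : ∀ {x} → CycleAt G S x → CycleAt G½ T (ι x)
    expandCycle (w@(step _ _ _ _) , _ , uE , uV) = expand w , s≤s z≤n , expand-unique w uE uV

    -- A T-walk alternates between old vertices and midpoints and passes each
    -- midpoint either by backtracking along one half or by crossing both halves.
    record Contraction {y₁ y₂} (w : Walk G½ T y₁ y₂) (x y : X) : Set where
      field
        walk     : Walk G S x y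
        edges⊆   : ∀ {i} → i ∈ walkEdges walk → first½ i ∈ walkEdges w
        verts⊆   : ∀ {v} → v ∈ walkVerts walk → ι v ∈ walkVerts w
        unique   : Unique (walkEdges w) → Unique (walkVerts w) → Unique (walkEdges walk) × Unique (walkVerts walk)
        nonempty : Unique (walkEdges w) → 1 ≤ length (walkEdges w) → 1 ≤ length (walkEdges walk)

    backtrack : ∀ {y₁ z z′ y₂ k x y} {k∈ k∈′ : k ∈ₛ T} {j : Joins (lookup E½ k) y₁ z} {j′ : Joins (lookup E½ k) z z′}
                {w : Walk G½ T z′ y₂} → Contraction w x y → Contraction (step k k∈ j (step k k∈′ j′ w)) x y
    backtrack c = record
      { walk     = walk
      ; edges⊆   = λ i∈ → there (there (edges⊆ i∈))
      ; verts⊆   = λ v∈ → there (there (verts⊆ v∈))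
      ; unique   = λ uE _ → ⊥-elim (Allₚ.All¬⇒¬Any (AllPairs.head uE) (here refl))
      ; nonempty = λ uE _ → ⊥-elim (Allₚ.All¬⇒¬Any (AllPairs.head uE) (here refl))
      }
      where open Contraction c

    cross : ∀ {y₁ z z′ y₂ k k′ i x c′ y} {k∈ : k ∈ₛ T} {k′∈ : k′ ∈ₛ T}
            {j : Joins (lookup E½ k) y₁ z} {j′ : Joins (lookup E½ k′) z z′} {w : Walk G½ T z′ y₂} →
            i ∈ₛ S → Joins (lookup xs i) x c′ → first½ i ≡ k ⊎ first½ i ≡ k′ → y₁ ≡ ι x →
            Contraction w c′ y → Contraction (step k k∈ j (step k′ k′∈ j′ w)) x y
    cross {i = i} {w = w} i∈S i-joins first≡ y₁≡ c = record
      { walk     = step i i∈S i-joins walk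
      ; edges⊆   = λ { (here refl) → first∈ ; (there i′∈) → there (there (edges⊆ i′∈)) }
      ; verts⊆   = λ { (here refl) → here (sym y₁≡) ; (there v∈) → there (there (verts⊆ v∈)) }
      ; unique   = λ uE uV → let (uE′ , uV′) = unique (AllPairs.tail (AllPairs.tail uE)) (AllPairs.tail (AllPairs.tail uV))
                             in Unique-∷ (i∉ uE) uE′ , Unique-∷ (x∉ uV) uV′
      ; nonempty = λ _ _ → s≤s z≤n
      }
      where
        open Contraction c
        first∈ : first½ i ∈ _ ∷ _ ∷ walkEdges w
        first∈ = [ (λ e → here e) , (λ e → there (here e)) ]′ first≡
        i∉ : Unique (_ ∷ _ ∷ walkEdges w) → i ∉ walkEdges walk
        i∉ (k∉ AllPairs.∷ k′∉ AllPairs.∷ _) i∈ =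
          [ (λ e → Allₚ.All¬⇒¬Any k∉ (there (subst (_∈ walkEdges w) e (edges⊆ i∈))))
          , (λ e → Allₚ.All¬⇒¬Any k′∉ (subst (_∈ walkEdges w) e (edges⊆ i∈))) ]′ first≡
        x∉ : Unique (_ ∷ _ ∷ walkVerts w) → _ ∉ walkVerts walk
        x∉ (y₁∉ AllPairs.∷ _) x∈ = Allₚ.All¬⇒¬Any y₁∉ (there (subst (_∈ walkVerts w) (sym y₁≡) (verts⊆ x∈)))

    contract : ∀ {y₁ y₂} (w : Walk G½ T y₁ y₂) {x y} → y₁ ≡ ι x → y₂ ≡ ι y → Contraction w x y
    contract [] y₁≡ y₂≡ with ι-injective (trans (sym y₁≡) y₂≡)
    ... | refl = record { walk = [] ; edges⊆ = λ () ; verts⊆ = λ () ; unique = λ _ _ → AllPairs.[] , AllPairs.[]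
                        ; nonempty = λ _ () }
    contract (step k _ j []) refl refl = ⊥-elim (¬joinsιι j)
    contract (step k k∈ j (step k′ k′∈ j′ w)) y₁≡ y₂≡ with joins⇒half j | joins⇒half j′
    ... | _ , _ , inj₂ (y₁≡mid , _) | _ = ⊥-elim (ι≢mid _ _ (trans (sym y₁≡) y₁≡mid))
    ... | _ , _ , inj₁ (_ , z≡mid) | _ , _ , inj₁ (z≡ι , _) = ⊥-elim (ι≢mid _ _ (trans (sym z≡ι) z≡mid))
    ... | c , half , inj₁ (y₁≡ιc , z≡mid) | c′ , half′ , inj₂ (z≡mid′ , z′≡ιc′) with k Fin.≟ k′
    ...   | yes refl = backtrack (contract w (trans (sym (Joins-functional _ (Joins-sym _ j) j′)) y₁≡) y₂≡)
    ...   | no k≢k′ with two-halves half (subst (λ i → Half i k′ c′) (sym same-edge) half′) k≢k′ k∈ k′∈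
      where same-edge = mid-injective (trans (sym z≡mid) z≡mid′)
    ...     | i∈S , i-joins , first≡ =
      cross i∈S (subst (λ a → Joins _ a c′) (ι-injective (trans (sym y₁≡ιc) y₁≡)) i-joins) first≡ y₁≡
            (contract w z′≡ιc′ y₂≡)

    contractCycleAt : ∀ {y x} → y ≡ ι x → CycleAt G½ T y → CycleAt G S x
    contractCycleAt y≡ιx (w , nonempty-w , uE , uV) = walk , nonempty uE nonempty-w , unique uE uV
      where open Contraction (contract w y≡ιx y≡ιx)

    -- a cycle through a midpoint is first rotated to start at an old vertex
    contractCycle : Cycle G½ T → Cycle G S
    contractCycle (_ , [] , () , _)
    contractCycle (y₀ , step k k∈ j w , _ , uE , uV) with ι-or-mid y₀
    ... | inj₁ (x , y₀≡ιx) = x , contractCycleAt y₀≡ιx (step k k∈ j w , s≤s z≤n , uE , uV)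
    ... | inj₂ (i , y₀≡mid) with joins⇒half j
    ...   | _ , _ , inj₁ (y₀≡ι , _) = ⊥-elim (ι≢mid _ _ (trans (sym y₀≡ι) y₀≡mid))
    ...   | c , _ , inj₂ (_ , z≡ιc) = c , contractCycleAt z≡ιc (rotateCycle k∈ j w uE uV)

    isolated : ∀ {i} → first½ i ∉ₛ T → second½ i ∉ₛ T →
               ∀ {y₁ y₂ a} → Walk G½ T y₁ y₂ → y₁ ≡ mid i → y₂ ≡ ι a → ⊥
    isolated _ _ [] y₁≡mid y₂≡ι = ι≢mid _ _ (trans (sym y₂≡ι) y₁≡mid)
    isolated first∉ second∉ (step k k∈ j w) y₁≡mid _ with joins⇒half j
    ... | _ , _    , inj₁ (y₁≡ι , _) = ι≢mid _ _ (trans (sym y₁≡ι) y₁≡mid)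
    ... | _ , half , inj₂ (y₁≡mid′ , _) with mid-injective (trans (sym y₁≡mid′) y₁≡mid)
    ...   | refl = [ (λ (k≡ , _) → first∉ (subst (_∈ₛ T) k≡ k∈))
                   , (λ (k≡ , _) → second∉ (subst (_∈ₛ T) k≡ k∈)) ]′ half

    reachOld : (∀ i → first½ i ∈ₛ T ⊎ second½ i ∈ₛ T) → ∀ y → ∃ λ x → Walk G½ T y (ι x)
    reachOld halfPresent y with ι-or-mid y
    ... | inj₁ (x , refl) = x , []
    ... | inj₂ (i , refl) with halfPresent i
    ...   | inj₁ first∈  = end₁ i , step (first½ i) first∈ (Joins-sym _ (half-joins (inj₁ (refl , refl)))) []
    ...   | inj₂ second∈ = end₂ i , step (second½ i) second∈ (Joins-sym _ (half-joins (inj₂ (refl , refl)))) []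

    tree⇒collapse : IsSpanningTree G½ T → (∀ i → first½ i ∈ₛ T ⊎ second½ i ∈ₛ T) × IsSpanningTree G S
    tree⇒collapse (connected , acyclic) =
      halfPresent ,
      (λ x y → Contraction.walk (contract (connected (ι x) (ι y)) refl refl)) ,
      (λ { (x , c) → acyclic (ι x , expandCycle c) })
      where
        halfPresent : ∀ i → first½ i ∈ₛ T ⊎ second½ i ∈ₛ T
        halfPresent i with first½ i ∈? T | second½ i ∈? T
        ... | yes first∈ | _          = inj₁ first∈
        ... | no _       | yes second∈ = inj₂ second∈
        ... | no first∉  | no second∉ = ⊥-elim (isolated first∉ second∉ (connected (mid i) (ι (end₁ i))) refl refl)

    collapse⇒tree : (∀ i → first½ i ∈ₛ T ⊎ second½ i ∈ₛ T) → IsSpanningTree G S → IsSpanningTree G½ T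
    collapse⇒tree halfPresent (connected , acyclic) = connected½ , acyclic ∘ contractCycle
      where
        connected½ : ∀ y₁ y₂ → Walk G½ T y₁ y₂
        connected½ y₁ y₂ with reachOld halfPresent y₁ | reachOld halfPresent y₂
        ... | x₁ , w₁ | x₂ , w₂ = w₁ ++ʷ (expand (connected x₁ x₂) ++ʷ reverseʷ w₂)

  lifts⇒tree : ∀ {S T} → IsSpanningTree G S → T ∈ lifts halves S → IsSpanningTree G½ T
  lifts⇒tree {S} {T} treeS T∈ =
    collapse⇒tree T halfPresent (subst (IsSpanningTree G) (sym (collapse-lifts subdivideAllowed-∧ {f = halves} T∈)) treeS)
    where
      halfPresent : ∀ i → first½ i ∈ₛ T ⊎ second½ i ∈ₛ T
      halfPresent i = Sum.map lookup⇒∈ₛ lookup⇒∈ₛ (subdivideAllowed-some (∈-lifts⁻ {f = halves} {S} T∈ i))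

  tree⇒lifts : ∀ {T} → IsSpanningTree G½ T → IsSpanningTree G (collapse halves T) × T ∈ lifts halves (collapse halves T)
  tree⇒lifts {T} treeT =
    proj₂ (tree⇒collapse T treeT) ,
    lifts-collapse {f = halves} T (λ i → subdivideAllowed-complete _ _
      (Sum.map ∈ₛ⇒lookup ∈ₛ⇒lookup (proj₁ (tree⇒collapse T treeT) i)))

  spanningTrees-subdivide : ∀ {t} s → (∀ {S} → IsSpanningTree G S → ∣ S ∣ ≡ s) → HasCount (IsSpanningTree G) t →
                            Σ[ t′ ∈ ℕ ] (HasCount (IsSpanningTree G½) t′ × 2 ^ s * t′ ≡ 2 ^ m * t)
  spanningTrees-subdivide s size =
    HasCount-lifts (lifts halves) (collapse halves) (Unique-lifts Unique-subdivideAllowed halves)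
                   (collapse-lifts subdivideAllowed-∧) lifts⇒tree tree⇒lifts (2 ^ s) (2 ^ m) fibre
    where
      fibre : ∀ {S} → IsSpanningTree G S → 2 ^ s * length (lifts halves S) ≡ 2 ^ m
      fibre {S} treeS = begin
        2 ^ s * length (lifts halves S) ≡⟨ cong (2 ^ s *_) (length-lifts not length-subdivideAllowed halves S) ⟩
        2 ^ s * 2 ^ ∣ ∁ S ∣             ≡⟨ sym (^-distribˡ-+-* 2 s _) ⟩
        2 ^ (s + ∣ ∁ S ∣)               ≡⟨ cong (λ n → 2 ^ (n + ∣ ∁ S ∣)) (sym (size treeS)) ⟩
        2 ^ (∣ S ∣ + ∣ ∁ S ∣)           ≡⟨ cong (2 ^_) (∣p∣+∣∁p∣≡n S) ⟩
        2 ^ m                           ∎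
        where open ≡-Reasoning

-- Contracting the distinguished edge

False-irrelevant : ∀ {P : Set} (d : Dec P) (p q : False d) → p ≡ q
False-irrelevant (yes _) () _
False-irrelevant (no _)  _  _ = refl

module Contraction (H : EGraph) (u≢v : u H ≢ v H) where

  private
    _≟_ = _≟V_ H
    W = CV H u≢v

  CV-≡ : ∀ {c c′ : W} → proj₁ c ≡ proj₁ c′ → c ≡ c′
  CV-≡ {x , p} {.x , q} refl = cong (x ,_) (False-irrelevant (x ≟ v H) p q)

  _≟CV_ : DecidableEquality W
  c ≟CV c′ = Dec.map′ CV-≡ (cong proj₁) (proj₁ c ≟ proj₁ c′)

  merge-cases : ∀ x → (x ≡ v H × proj₁ (merge H u≢v x) ≡ u H) ⊎ (x ≢ v H × proj₁ (merge H u≢v x) ≡ x)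
  merge-cases x with x ≟ v H
  ... | yes x≡v = inj₁ (x≡v , refl)
  ... | no  x≢v = inj₂ (x≢v , refl)

  mergeEdge : Vt H × Vt H → W × W
  mergeEdge (x , y) = merge H u≢v x , merge H u≢v y

  Contracted : Graph
  Contracted = record { V = W ; edges = map mergeEdge (rest H) }

  Survives : Vt H × Vt H → Set
  Survives (x , y) = x ≢ y × (x , y) ≢ (u H , v H) × (x , y) ≢ (v H , u H)

  survives⇒¬loop : ∀ {q} → Survives q → proj₁ (proj₁ (mergeEdge q)) ≢ proj₁ (proj₂ (mergeEdge q))
  survives⇒¬loop {x , y} (x≢y , ≢uv , ≢vu) x′≡y′ with merge-cases x | merge-cases y
  ... | inj₁ (x≡v , _)   | inj₁ (y≡v , _)   = x≢y (trans x≡v (sym y≡v))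
  ... | inj₁ (x≡v , x′≡u) | inj₂ (_ , y′≡y)  = ≢vu (cong₂ _,_ x≡v (trans (sym y′≡y) (trans (sym x′≡y′) x′≡u)))
  ... | inj₂ (_ , x′≡x)  | inj₁ (y≡v , y′≡u) = ≢uv (cong₂ _,_ (trans (sym x′≡x) (trans x′≡y′ y′≡u)) y≡v)
  ... | inj₂ (_ , x′≡x)  | inj₂ (_ , y′≡y)  = x≢y (trans (sym x′≡x) (trans x′≡y′ y′≡y))

  contractE≡Contracted : All Survives (rest H) → contractE H u≢v ≡ Contracted
  contractE≡Contracted survive = cong (λ es → record { V = W ; edges = es })
    (List.filter-all (λ q → ¬? (proj₁ (proj₁ q) ≟ proj₁ (proj₂ q))) (Allₚ.map⁺ (All.map survives⇒¬loop survive)))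

  survivors : List (Vt H) → List W
  survivors []       = []
  survivors (x ∷ xs) with x ≟ v H
  ... | yes _   = survivors xs
  ... | no  x≢v = (x , fromWitnessFalse x≢v) ∷ survivors xs

  open Without _≟_

  map-proj₁-survivors : ∀ xs → map proj₁ (survivors xs) ≡ xs without v H
  map-proj₁-survivors []       = refl
  map-proj₁-survivors (x ∷ xs) with x ≟ v H
  ... | yes _ = map-proj₁-survivors xs
  ... | no  _ = cong (x ∷_) (map-proj₁-survivors xs)

  ∈-survivors : ∀ {xs} (c : W) → proj₁ c ∈ xs → c ∈ survivors xs
  ∈-survivors {xs} c c∈xs with ∈-map⁻ proj₁ (subst (proj₁ c ∈_) (sym (map-proj₁-survivors xs))
                                               (∈-filter⁺ _ c∈xs (toWitnessFalse (proj₂ c))))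
  ... | c′ , c′∈ , c≡c′ = subst (_∈ survivors xs) (sym (CV-≡ c≡c′)) c′∈

  Unique-survivors : ∀ {xs} → Unique xs → Unique (survivors xs)
  Unique-survivors {xs} u = Uniqueₚ.map⁻ (subst Unique (sym (map-proj₁-survivors xs)) (Uniqueₚ.filter⁺ _ u))

  length-survivors : ∀ {xs} → Unique xs → v H ∈ xs → suc (length (survivors xs)) ≡ length xs
  length-survivors {xs} u v∈ = trans (cong suc (trans (sym (List.length-map proj₁ (survivors xs)))
                                                      (cong length (map-proj₁-survivors xs))))
                                     (length-without u v∈)

concatMap-copies : ∀ {X : Set} (xs : List (X × X)) →
                   concatMap (λ p → p ∷ p ∷ []) xs ≡ pairUp (length xs) (Doubled.copies xs)
concatMap-copies xs = trans (cong (concatMap (λ p → p ∷ p ∷ [])) (sym (List.tabulate-lookup xs)))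
                            (concatMap-tabulate (λ p → p , p) (lookup xs))

rest-halve : ∀ H → rest (halve H) ≡ pairUp (length (rest H)) (Subdivided.halves inj₁ (rest H) inj₂)
rest-halve H = concatMap-tabulate (Subdivided.halves inj₁ (rest H) inj₂) id

module ContractDouble (H : EGraph) (u≢v : u H ≢ v H) where

  open Contraction H u≢v
  module C² = Contraction (double H) u≢v

  merge-double : ∀ x → merge (double H) u≢v x ≡ merge H u≢v x
  merge-double x with C².merge-cases x | merge-cases x
  ... | inj₁ (_ , x′≡u) | inj₁ (_ , x″≡u) = CV-≡ (trans x′≡u (sym x″≡u))
  ... | inj₁ (x≡v , _)  | inj₂ (x≢v , _)  = ⊥-elim (x≢v x≡v)
  ... | inj₂ (x≢v , _)  | inj₁ (x≡v , _)  = ⊥-elim (x≢v x≡v)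
  ... | inj₂ (_ , x′≡x) | inj₂ (_ , x″≡x) = CV-≡ (trans x′≡x (sym x″≡x))

  Survives-double : All Survives (rest H) → All C².Survives (rest (double H))
  Survives-double survive = Allₚ.concat⁺ (Allₚ.map⁺ (All.map (λ s → s ∷ s ∷ []) survive))

  Contracted-double : C².Contracted ≡ Doubled.G² (map mergeEdge (rest H))
  Contracted-double = cong (λ es → record { V = CV H u≢v ; edges = es }) (begin
    map C².mergeEdge (concatMap (λ p → p ∷ p ∷ []) (rest H))  ≡⟨ List.map-cong (λ (x , y) → cong₂ _,_ (merge-double x)
                                                                                                    (merge-double y)) _ ⟩
    map mergeEdge (concatMap (λ p → p ∷ p ∷ []) (rest H))     ≡⟨ trans (List.map-concatMap mergeEdge (λ p → p ∷ p ∷ []) (rest H))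
                                                                    (sym (List.concatMap-map (λ p → p ∷ p ∷ []) mergeEdge (rest H))) ⟩
    concatMap (λ p → p ∷ p ∷ []) (map mergeEdge (rest H))     ≡⟨ concatMap-copies (map mergeEdge (rest H)) ⟩
    pairUp _ (Doubled.copies (map mergeEdge (rest H)))         ∎)
    where open ≡-Reasoning

module ContractHalve (H : EGraph) (u≢v : u H ≢ v H) where

  open Contraction H u≢v
  private
    m = length (rest H)
    H½ = halve H
    u≢v½ : u H½ ≢ v H½
    u≢v½ = inj₁-≢ u≢v
  module C½ = Contraction H½ u≢v½

  oldVertex : CV H u≢v → CV H½ u≢v½
  oldVertex (x , p) = inj₁ x , fromWitnessFalse (λ e → toWitnessFalse p (Sumₚ.inj₁-injective e))

  midpoint : Fin m → CV H½ u≢v½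
  midpoint i = inj₂ i , fromWitnessFalse {a? = _≟V_ H½ (inj₂ i) (v H½)} λ ()

  merge-inj₁ : ∀ x → merge H½ u≢v½ (inj₁ x) ≡ oldVertex (merge H u≢v x)
  merge-inj₁ x with C½.merge-cases (inj₁ x) | merge-cases x
  ... | inj₁ (_ , x′≡u) | inj₁ (_ , x″≡u) = C½.CV-≡ (trans x′≡u (cong inj₁ (sym x″≡u)))
  ... | inj₁ (x≡v , _)  | inj₂ (x≢v , _)  = ⊥-elim (x≢v (Sumₚ.inj₁-injective x≡v))
  ... | inj₂ (x≢v , _)  | inj₁ (x≡v , _)  = ⊥-elim (x≢v (cong inj₁ x≡v))
  ... | inj₂ (_ , x′≡x) | inj₂ (_ , x″≡x) = C½.CV-≡ (trans x′≡x (cong inj₁ (sym x″≡x)))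

  merge-inj₂ : ∀ i → merge H½ u≢v½ (inj₂ i) ≡ midpoint i
  merge-inj₂ i with C½.merge-cases (inj₂ i)
  ... | inj₁ (() , _)
  ... | inj₂ (_ , i′≡i) = C½.CV-≡ i′≡i

  Survives-halve : All C½.Survives (rest H½)
  Survives-halve = subst (All C½.Survives) (sym (rest-halve H))
    (All-pairUp (λ _ → ((λ ()) , (λ ()) , (λ ())) , ((λ ()) , (λ ()) , (λ ()))))

  private
    length-map-merge : length (map mergeEdge (rest H)) ≡ m
    length-map-merge = List.length-map mergeEdge (rest H)

  midpointᶜ : Fin (length (map mergeEdge (rest H))) → CV H½ u≢v½
  midpointᶜ = midpoint ∘ Fin.cast length-map-merge

  Contracted-halve : C½.Contracted ≡ Subdivided.G½ oldVertex (map mergeEdge (rest H)) midpointᶜ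
  Contracted-halve = cong (λ es → record { V = CV H½ u≢v½ ; edges = es }) (begin
    map C½.mergeEdge (rest H½)                                    ≡⟨ cong (map C½.mergeEdge) (rest-halve H) ⟩
    map C½.mergeEdge (pairUp m (Subdivided.halves inj₁ (rest H) inj₂))  ≡⟨ map-pairUp C½.mergeEdge _ ⟩
    pairUp m merged                                               ≡⟨ pairUp-cast length-map-merge merged ⟩
    pairUp _ (merged ∘ Fin.cast length-map-merge)                 ≡⟨ pairUp-cong relabel ⟩
    pairUp _ (Subdivided.halves oldVertex (map mergeEdge (rest H)) midpointᶜ) ∎)
    where
      open ≡-Reasoning
      merged : Fin m → _
      merged i = (C½.mergeEdge (inj₁ (proj₁ (lookup (rest H) i)) , inj₂ i)) ,
                 (C½.mergeEdge (inj₂ i , inj₁ (proj₂ (lookup (rest H) i))))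
      relabel : ∀ i → merged (Fin.cast length-map-merge i) ≡ Subdivided.halves oldVertex (map mergeEdge (rest H)) midpointᶜ i
      relabel i
        rewrite merge-inj₁ (proj₁ (lookup (rest H) (Fin.cast length-map-merge i)))
              | merge-inj₁ (proj₂ (lookup (rest H) (Fin.cast length-map-merge i)))
              | merge-inj₂ (Fin.cast length-map-merge i)
              | lookup-map mergeEdge (rest H) i = refl

  oldVertex-injective : ∀ {c c′} → oldVertex c ≡ oldVertex c′ → c ≡ c′
  oldVertex-injective eq = CV-≡ (Sumₚ.inj₁-injective (cong proj₁ eq))

  midpointᶜ-injective : ∀ {i j} → midpointᶜ i ≡ midpointᶜ j → i ≡ j
  midpointᶜ-injective {i} {j} eq = begin
    i                                                         ≡⟨ sym (Finₚ.cast-involutive (sym length-map-merge) length-map-merge i) ⟩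
    Fin.cast (sym length-map-merge) (Fin.cast length-map-merge i) ≡⟨ cong (Fin.cast (sym length-map-merge)) (Sumₚ.inj₂-injective (cong proj₁ eq)) ⟩
    Fin.cast (sym length-map-merge) (Fin.cast length-map-merge j) ≡⟨ Finₚ.cast-involutive (sym length-map-merge) length-map-merge j ⟩
    j                                                         ∎
    where open ≡-Reasoning

  oldVertex≢midpointᶜ : ∀ c i → oldVertex c ≢ midpointᶜ i
  oldVertex≢midpointᶜ _ _ eq with cong proj₁ eq
  ... | ()

  oldVertex-or-midpointᶜ : ∀ y → (∃ λ c → y ≡ oldVertex c) ⊎ (∃ λ i → y ≡ midpointᶜ i)
  oldVertex-or-midpointᶜ (inj₁ x , p) = inj₁ ((x , fromWitnessFalse (λ x≡v → toWitnessFalse p (cong inj₁ x≡v))) , C½.CV-≡ refl)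
  oldVertex-or-midpointᶜ (inj₂ j , p) =
    inj₂ (Fin.cast (sym length-map-merge) j , C½.CV-≡ (cong inj₂ (sym (Finₚ.cast-involutive length-map-merge (sym length-map-merge) j))))

inj₁-or-inj₂ : ∀ {A B : Set} (y : A ⊎ B) → (∃ λ x → y ≡ inj₁ x) ⊎ (∃ λ i → y ≡ inj₂ i)
inj₁-or-inj₂ (inj₁ x) = inj₁ (x , refl)
inj₁-or-inj₂ (inj₂ i) = inj₂ (i , refl)

module Counts (H : EGraph) (u≢v : u H ≢ v H) (survive : All (Contraction.Survives H u≢v) (rest H))
              (k : ℕ) (vs : List (Vt H)) (vs-unique : Unique vs) (vs-complete : ∀ x → x ∈ vs)
              (length-vs : length vs ≡ suc (suc k)) where

  open Contraction H u≢v
  open ContractDouble H u≢v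
  open ContractHalve H u≢v

  private
    transport : ∀ {G G′ : Graph} {t} → G ≡ G′ → NumSpanningTrees G t → NumSpanningTrees G′ t
    transport G≡G′ = subst (λ G → NumSpanningTrees G _) G≡G′

    contracted : ∀ {w} → NumSpanningTrees (contractE H u≢v) w → NumSpanningTrees Contracted w
    contracted = transport (contractE≡Contracted survive)

  deleteE-size : ∀ {T} → IsSpanningTree (deleteE H) T → ∣ T ∣ ≡ suc k
  deleteE-size treeT = suc-injective (trans
    (TreeSize.spanningTree-size (deleteE H) (_≟V_ H) vs vs-unique vs-complete treeT (u H)) length-vs)

  Contracted-size : ∀ {T} → IsSpanningTree Contracted T → ∣ T ∣ ≡ k
  Contracted-size treeT = suc-injective (suc-injective (trans
    (cong suc (TreeSize.spanningTree-size Contracted _≟CV_ (survivors vs) (Unique-survivors vs-unique)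
                 (λ c → ∈-survivors c (vs-complete (proj₁ c))) treeT (merge H u≢v (u H))))
    (trans (length-survivors vs-unique (vs-complete (v H))) length-vs)))

  double-deleteE : ∀ {z} → NumSpanningTrees (deleteE H) z → NumSpanningTrees (deleteE (double H)) (2 ^ suc k * z)
  double-deleteE τ =
    transport (cong (λ es → record { V = Vt H ; edges = es }) (sym (concatMap-copies (rest H))))
              (Doubling.spanningTrees-double (_≟V_ H) (rest H) (suc k) deleteE-size τ)

  double-contractE : ∀ {w} → NumSpanningTrees (contractE H u≢v) w →
                     NumSpanningTrees (contractE (double H) u≢v) (2 ^ k * w)
  double-contractE τ =
    transport (sym (trans (C².contractE≡Contracted (Survives-double survive)) Contracted-double))
              (Doubling.spanningTrees-double _≟CV_ (map mergeEdge (rest H)) k Contracted-size (contracted τ))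

  private
    module S½  = Subdivision inj₁ (rest H) inj₂ Sumₚ.inj₁-injective Sumₚ.inj₂-injective (λ _ _ ()) inj₁-or-inj₂
    module Sᶜ½ = Subdivision oldVertex (map mergeEdge (rest H)) midpointᶜ oldVertex-injective midpointᶜ-injective
                   oldVertex≢midpointᶜ oldVertex-or-midpointᶜ

  halve-deleteE : ∀ {x z} → NumSpanningTrees (deleteE H) z → NumSpanningTrees (deleteE (halve H)) x →
                  2 ^ suc k * x ≡ 2 ^ length (rest H) * z
  halve-deleteE τ τ½ =
    let (_ , τ½′ , scaled) = S½.spanningTrees-subdivide (suc k) deleteE-size τ
        halved = cong (λ es → record { V = Vt H ⊎ Fin _ ; edges = es }) (sym (rest-halve H))
    in subst (λ t → 2 ^ suc k * t ≡ _) (HasCount-functional (transport halved τ½′) τ½) scaled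

  halve-contractE : ∀ {y w} → NumSpanningTrees (contractE H u≢v) w →
                    NumSpanningTrees (contractE (halve H) (inj₁-≢ u≢v)) y → 2 ^ k * y ≡ 2 ^ length (rest H) * w
  halve-contractE {w = w} τ τ½ =
    let (_ , τ½′ , scaled) = Sᶜ½.spanningTrees-subdivide k Contracted-size (contracted τ)
        halved = sym (trans (C½.contractE≡Contracted Survives-halve) Contracted-halve)
    in subst (λ t → 2 ^ k * t ≡ _) (HasCount-functional (transport halved τ½′) τ½)
             (trans scaled (cong (λ l → 2 ^ l * w) (List.length-map mergeEdge (rest H))))

doubling-ratio : ∀ k {x y z w} → x ≡ 2 ^ suc k * z → y ≡ 2 ^ k * w → x * w ≡ 2 * (z * y)
doubling-ratio k {z = z} {w} refl refl = shuffle (2 ^ k) z w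
  where
    shuffle : ∀ p z w → (2 * p * z) * w ≡ 2 * (z * (p * w))
    shuffle = solve-∀

halving-ratio : ∀ k M {x y z w} → 2 ^ suc k * x ≡ M * z → 2 ^ k * y ≡ M * w → 2 * (x * w) ≡ z * y
halving-ratio k M {x} {y} {z} {w} scaled-x scaled-y =
  *-cancelˡ-≡ _ _ (p * p) {{m*n≢0 p p {{m^n≢0 2 k}} {{m^n≢0 2 k}}}} (begin
    p * p * (2 * (x * w)) ≡⟨ shuffle₁ p x w ⟩
    p * (2 * p * x * w)   ≡⟨ cong (λ t → p * (t * w)) scaled-x ⟩
    p * (M * z * w)       ≡⟨ shuffle₂ p M z w ⟩
    p * (z * (M * w))     ≡⟨ cong (λ t → p * (z * t)) (sym scaled-y) ⟩
    p * (z * (p * y))     ≡⟨ shuffle₃ p z y ⟩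
    p * p * (z * y)       ∎)
  where
    open ≡-Reasoning
    p = 2 ^ k
    shuffle₁ : ∀ p x w → p * p * (2 * (x * w)) ≡ p * (2 * p * x * w)
    shuffle₁ = solve-∀
    shuffle₂ : ∀ p M z w → p * (M * z * w) ≡ p * (z * (M * w))
    shuffle₂ = solve-∀
    shuffle₃ : ∀ p z y → p * (z * (p * y)) ≡ p * p * (z * y)
    shuffle₃ = solve-∀

equal-ratio : ∀ {p q} M {x y z w} .{{_ : NonZero p}} .{{_ : NonZero q}} →
              p * x ≡ M * (p * z) → q * y ≡ M * (q * w) → x * w ≡ z * y
equal-ratio {p} {q} M {x} {y} {z} {w} scaled-x scaled-y = begin
  x * w       ≡⟨ cong (_* w) (*-cancelˡ-≡ x (M * z) p (trans scaled-x (swap M p z))) ⟩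
  M * z * w   ≡⟨ shuffle M z w ⟩
  z * (M * w) ≡⟨ cong (z *_) (sym (*-cancelˡ-≡ y (M * w) q (trans scaled-y (swap M q w)))) ⟩
  z * y       ∎
  where
    open ≡-Reasoning
    swap : ∀ M p z → M * (p * z) ≡ p * (M * z)
    swap = solve-∀
    shuffle : ∀ M z w → M * z * w ≡ z * (M * w)
    shuffle = solve-∀

simple⇒survives : ∀ {n} {a b : Fin n} {es} (a≢b : a ≢ b) → Simple (whole (baseEG n a b es)) →
                 All (Contraction.Survives (baseEG n a b es) a≢b) es
simple⇒survives {es = es} a≢b (noLoop , noParallel) =
  subst (All _) (List.tabulate-lookup es) (Allₚ.tabulate⁺ (λ i →
    noLoop (suc i) , (λ eq → noParallel (suc i) zero (λ ()) (inj₁ eq)) , (λ eq → noParallel (suc i) zero (λ ()) (inj₂ eq))))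

lemma2p4 : (n : ℕ) (a b : Fin n) (es : List (Fin n × Fin n)) →
    (a≢b : a ≢ b) →
    Simple (whole (baseEG n a b es)) →
    Connected (whole (baseEG n a b es)) →
    Planar n ((a , b) ∷ es) →
    ¬ IsBridge (baseEG n a b es) →
      -- ζ(G',e) = 2 ζ(G,e)
      ((∀ x y z w →
        NumSpanningTrees (deleteE (double (baseEG n a b es))) x →
        NumSpanningTrees (contractE (double (baseEG n a b es)) a≢b) y →
        NumSpanningTrees (deleteE (baseEG n a b es)) z →
        NumSpanningTrees (contractE (baseEG n a b es) a≢b) w →
        x * w ≡ 2 * (z * y))
      -- ζ(G'',e) = ζ(G,e) / 2
      × (∀ x y z w →
        NumSpanningTrees (deleteE (halve (baseEG n a b es))) x →
        NumSpanningTrees (contractE (halve (baseEG n a b es)) (inj₁-≢ a≢b)) y →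
        NumSpanningTrees (deleteE (baseEG n a b es)) z →
        NumSpanningTrees (contractE (baseEG n a b es) a≢b) w →
        2 * (x * w) ≡ z * y)
      -- ζ(G°,e) = ζ(G,e)
      × (∀ x y z w →
        NumSpanningTrees (deleteE (simplify (baseEG n a b es))) x →
        NumSpanningTrees (contractE (simplify (baseEG n a b es)) (inj₁-≢ a≢b)) y →
        NumSpanningTrees (deleteE (baseEG n a b es)) z →
        NumSpanningTrees (contractE (baseEG n a b es) a≢b) w →
        x * w ≡ z * y))
lemma2p4 (suc zero) zero zero _ a≢b _ _ _ _ = ⊥-elim (a≢b refl)
lemma2p4 (suc (suc k)) a b es a≢b simple _ _ _ =
  (λ x y z w τx τy τz τw →
    doubling-ratio k (HasCount-functional τx (double-deleteE τz)) (HasCount-functional τy (double-contractE τw))) ,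
  (λ x y z w τx τy τz τw →
    halving-ratio k (2 ^ length es) {x} {y} {z} {w} (halve-deleteE τz τx) (halve-contractE τw τy)) ,
  (λ x y z w τx τy τz τw →
    equal-ratio (2 ^ length (rest (double H))) {x} {y} {z} {w} {{m^n≢0 2 (suc k)}} {{m^n≢0 2 k}}
      (G′.halve-deleteE (double-deleteE τz) τx) (G′.halve-contractE (double-contractE τw) τy))
  where
    H = baseEG (suc (suc k)) a b es
    survive = simple⇒survives a≢b simple
    open Counts H a≢b survive k (allFin _) (Uniqueₚ.allFin⁺ _) ∈-allFin (List.length-tabulate id)
    module G′ = Counts (double H) a≢b (ContractDouble.Survives-double H a≢b survive) k
                       (allFin _) (Uniqueₚ.allFin⁺ _) ∈-allFin (List.length-tabulate id)
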